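{- Let $\mathbb I$ be an interface and $\mathbb I'$ an interface that is a refinement of $\mathbb I$ (i.e. the partition $\mathbb I'$ is finer than $\mathbb I$). For all processes $p,q$, if $p\sqsubseteq^{\mathrm{unc}}_{\mathbb I}q$ then $p\sqsubseteq^{\mathrm{unc}}_{\mathbb I'}q$.
   Context: Names $\mathcal N$, co-names $\bar a$ ($\bar{\bar a}=a$), $\mathsf{Act}=\mathcal N\cup\bar{\mathcal N}$, internal action $\tau\notin\mathsf{Act}$, success $\checkmark$. Processes: $p::=\mathbf 0\mid\mathbf 1\mid\mu.p\mid p+q\mid X\mid \mathrm{rec}_X.p$ ($\mu\in\mathsf{Act}\cup\{\tau\}$), with transitions $\mathbf 1\xrightarrow{\checkmark}\mathbf 0$, $\mu.p\xrightarrow{\mu}p$, choice moving as either summand, recursion unfolded. Configurations $c::=p\mid c\parallel d$: interleaving of $\mu$-moves, $\tau$-synchronisation of complementary actions, and $c\parallel d\xrightarrow{\checkmark}c'\parallel d'$ only when both sides do $\checkmark$. $\mathtt n(p)$: names $a$ with $a$ or $\bar a$ occurring in $p$. $p\ \mathsf{must}\ o$ iff every maximal $\tau$-computation of $p\parallel o$ (infinite or ending with no $\tau$-move) passes through a state $p_j\parallel o_j$ with $o_j\xrightarrow{\checkmark}$. An interface is a partition $\mathbb I=\{I_i\}_{i\in0..n}$ of $\mathsf{Act}$ with $\alpha\in I_i\Rightarrow\bar\alpha\in I_i$. Uncoordinated preorder: $p\sqsubseteq^{\mathrm{unc}}_{\mathbb I}q$ iff for all processes $o_0,\dots,o_n$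 with $\mathtt n(o_i)\subseteq I_i$, $p\ \mathsf{must}\ (o_0\parallel\cdots\parallel o_n)$ implies $q\ \mathsf{must}\ (o_0\parallel\cdots\parallel o_n)$. -}

module Defs where

open import Data.Nat using (ℕ; zero; suc; pred; _<_; _≤_; _<ᵇ_; _≡ᵇ_)
open import Data.Bool using (if_then_else_)
open import Data.Fin using (Fin)
import Data.Fin as F
open import Data.Product using (Σ; ∃; _×_; _,_; proj₁; proj₂)
open import Relation.Binary.PropositionalEquality using (_≡_)
open import Relation.Nullary using (¬_)

Name : Set
Name = ℕ

data Act : Set where
  nm  : Name → Act
  co  : Name → Act

bar : Act → Act
bar (nm a) = co a
bar (co a) = nm a

data Pre : Set where
  act : Act → Pre
  τ   : Pre

data Lab : Set where
  pre : Pre → Lab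
  ✓   : Lab

-- Processes, with recursion variables as de Bruijn indices
-- (var k refers to the k-th enclosing rec binder; rec binds index 0).

data Proc : Set where
  𝟘    : Proc
  𝟙    : Proc
  _∙_  : Pre → Proc → Proc
  _⊕_  : Proc → Proc → Proc
  var  : ℕ → Proc
  rec  : Proc → Proc

shift : ℕ → Proc → Proc
shift c 𝟘 = 𝟘
shift c 𝟙 = 𝟙
shift c (μ ∙ p) = μ ∙ shift c p
shift c (p ⊕ q) = shift c p ⊕ shift c q
shift c (var k) = if k <ᵇ c then var k else var (suc k)
shift c (rec p) = rec (shift (suc c) p)

-- capture-avoiding substitution of s for variable j (variables above j decremented)
subst : ℕ → Proc → Proc → Proc
subst j s 𝟘 = 𝟘
subst j s 𝟙 = 𝟙
subst j s (μ ∙ p) = μ ∙ subst j s p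
subst j s (p ⊕ q) = subst j s p ⊕ subst j s q
subst j s (var k) = if k ≡ᵇ j then s else (if k <ᵇ j then var k else var (pred k))
subst j s (rec p) = rec (subst (suc j) (shift 0 s) p)

data _─[_]→_ : Proc → Lab → Proc → Set where
  succ  : 𝟙 ─[ ✓ ]→ 𝟘
  pref  : ∀ {μ p} → (μ ∙ p) ─[ pre μ ]→ p
  sumL  : ∀ {p q l p'} → p ─[ l ]→ p' → (p ⊕ q) ─[ l ]→ p'
  sumR  : ∀ {p q l q'} → q ─[ l ]→ q' → (p ⊕ q) ─[ l ]→ q'
  unf   : ∀ {p l p'} → subst 0 (rec p) p ─[ l ]→ p' → rec p ─[ l ]→ p'

data _∈n_ : Name → Proc → Set where
  here-nm : ∀ {a p} → a ∈n (act (nm a) ∙ p)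
  here-co : ∀ {a p} → a ∈n (act (co a) ∙ p)
  there   : ∀ {a μ p} → a ∈n p → a ∈n (μ ∙ p)
  inL     : ∀ {a p q} → a ∈n p → a ∈n (p ⊕ q)
  inR     : ∀ {a p q} → a ∈n q → a ∈n (p ⊕ q)
  inRec   : ∀ {a p} → a ∈n p → a ∈n rec p

data Conf : Set where
  ⟨_⟩  : Proc → Conf
  _∥_  : Conf → Conf → Conf

data _═[_]⇒_ : Conf → Lab → Conf → Set where
  lift  : ∀ {p l p'} → p ─[ l ]→ p' → ⟨ p ⟩ ═[ l ]⇒ ⟨ p' ⟩
  parL  : ∀ {c d μ c'} → c ═[ pre μ ]⇒ c' → (c ∥ d) ═[ pre μ ]⇒ (c' ∥ d)
  parR  : ∀ {c d μ d'} → d ═[ pre μ ]⇒ d' → (c ∥ d) ═[ pre μ ]⇒ (c ∥ d')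
  sync  : ∀ {c d α c' d'} → c ═[ pre (act α) ]⇒ c' → d ═[ pre (act (bar α)) ]⇒ d'
        → (c ∥ d) ═[ pre τ ]⇒ (c' ∥ d')
  both✓ : ∀ {c d c' d'} → c ═[ ✓ ]⇒ c' → d ═[ ✓ ]⇒ d' → (c ∥ d) ═[ ✓ ]⇒ (c' ∥ d')

-- states p_j ∥ o_j of the computation of p ∥ o
State : Set
State = Conf × Conf

Step : State → State → Set
Step (c , d) (c' , d') = (c ∥ d) ═[ pre τ ]⇒ (c' ∥ d')

Successful : State → Set
Successful (c , d) = ∃ λ d' → d ═[ ✓ ]⇒ d'

record InfComp (s : State) : Set where
  field
    seq   : ℕ → State
    start : seq 0 ≡ s
    steps : ∀ i → Step (seq i) (seq (suc i))

record FinMaxComp (s : State) : Set where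
  field
    len   : ℕ
    seq   : ℕ → State          -- only the states 0 .. len matter
    start : seq 0 ≡ s
    steps : ∀ i → i < len → Step (seq i) (seq (suc i))
    stuck : ∀ s' → ¬ Step (seq len) s'

_must_ : Proc → Conf → Set
p must o =
  ((κ : InfComp (⟨ p ⟩ , o)) → ∃ λ j → Successful (InfComp.seq κ j))
  × ((κ : FinMaxComp (⟨ p ⟩ , o)) →
       ∃ λ j → j ≤ FinMaxComp.len κ × Successful (FinMaxComp.seq κ j))

-- Interfaces: partitions {I_i}_{i ∈ 0..n} of Act into nonempty blocks,
-- each closed under complement; block of α is `part α`.

record Interface : Set where
  field
    n        : ℕ
    part     : Act → Fin (suc n)
    closed   : ∀ α → part (bar α) ≡ part α
    nonempty : ∀ (i : Fin (suc n)) → ∃ λ α → part α ≡ i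

open Interface public

Refines : Interface → Interface → Set
Refines I' I = ∀ (j : Fin (suc (n I'))) → ∃ λ (i : Fin (suc (n I))) →
  ∀ α → part I' α ≡ j → part I α ≡ i

parAll : ∀ {k} → (Fin (suc k) → Proc) → Conf
parAll {zero}  o = ⟨ o F.zero ⟩
parAll {suc k} o = ⟨ o F.zero ⟩ ∥ parAll (λ i → o (F.suc i))

_⊑unc[_]_ : Proc → Interface → Proc → Set
p ⊑unc[ I ] q = ∀ (o : Fin (suc (n I)) → Proc) →
  (∀ i a → a ∈n o i → part I (nm a) ≡ i) →
  p must parAll o → q must parAll o

-- Tests for the finer interface I' are regrouped by the block of I containing
-- their block of I'. The parallel composition of the tests falling into one
-- block of I is strongly bisimilar to a single process over the names of that
-- block: a process has finitely many positions, so every configuration is a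
-- finite graph, and a finite graph unfolds back into a process with one rec
-- binder per vertex. Since parallel composition is associative, commutative and
-- has unit 1 up to bisimilarity, and must testing only sees a test up to
-- bisimilarity, p and q pass the regrouped I-test exactly when they pass the
-- original I'-test.

module Submission where

open import Defs
open import Level using (0ℓ) renaming (suc to lsuc)
open import Data.Bool using (true; false; T)
open import Data.Empty using (⊥; ⊥-elim)
open import Data.Fin using (Fin; zero; suc)
open import Data.Fin.Properties using (suc-injective; injective⇒≤) renaming (_≟_ to _≟ᶠ_)
open import Data.List using (List; []; _∷_; length; map; lookup; _++_; cartesianProduct; allFin)
open import Data.List.Membership.Propositional using (_∈_)
open import Data.List.Membership.Propositional.Properties
  using (∈-lookup; ∈-map⁺; ∈-++⁺ˡ; ∈-++⁺ʳ; ∈-cartesianProduct⁺; ∈-allFin)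
open import Data.List.Relation.Unary.All using (All; []; _∷_)
open import Data.List.Relation.Unary.Any using (here; there; index)
open import Data.List.Relation.Unary.Any.Properties using (lookup-index)
open import Data.Maybe using (Maybe; just; nothing; maybe)
import Data.Maybe as Maybe
open import Data.Nat using (ℕ; zero; suc; pred; _+_; _⊔_; _<_; _≤_; _<ᵇ_; _≡ᵇ_; z≤n; s≤s; _≤?_)
  renaming (_≟_ to _≟ℕ_)
open import Data.Nat.Properties
  using (<⇒<ᵇ; <ᵇ⇒<; ≡⇒≡ᵇ; ≡ᵇ⇒≡; <⇒≱; <⇒≢; <⇒≯; <⇒≤; <-≤-trans; ≤-<-trans; ≤-refl; ≤-trans; ≤-reflexive;
         m≤n⇒m≤1+n; pred-mono-≤; <-cmp; n≤1+n; m≤m⊔n; m≤n⊔m; +-suc; +-identityʳ; 1+n≰n)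
open import Data.Product using (Σ; ∃; _×_; _,_; proj₁; proj₂)
open import Data.Product.Properties using (≡-dec)
open import Data.Sum using (_⊎_; inj₁; inj₂)
open import Data.Unit using (⊤; tt)
open import Relation.Binary.Bundles using (Setoid)
open import Relation.Binary.Definitions using (tri<; tri≈; tri>)
open import Relation.Binary.PropositionalEquality
  using (_≡_; refl; sym; trans; cong; cong₂; module ≡-Reasoning) renaming (subst to ≡-subst)
import Relation.Binary.Reasoning.Setoid as SetoidReasoning
open import Relation.Nullary using (¬_; Dec; yes; no)
open import Relation.Nullary.Decidable using (map′)

-- De Bruijn substitution

shift-var-< : ∀ {c k} → k < c → shift c (var k) ≡ var k
shift-var-< {c} {k} k<c with k <ᵇ c in eq
... | true  = refl
... | false = ⊥-elim (≡-subst T eq (<⇒<ᵇ k<c))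

shift-var-≥ : ∀ {c k} → c ≤ k → shift c (var k) ≡ var (suc k)
shift-var-≥ {c} {k} c≤k with k <ᵇ c in eq
... | true  = ⊥-elim (<⇒≱ (<ᵇ⇒< k c (≡-subst T (sym eq) tt)) c≤k)
... | false = refl

subst-var-≡ : ∀ {j s} → subst j s (var j) ≡ s
subst-var-≡ {j} with j ≡ᵇ j in eq
... | true  = refl
... | false = ⊥-elim (≡-subst T eq (≡⇒≡ᵇ j j refl))

subst-var-< : ∀ {j s k} → k < j → subst j s (var k) ≡ var k
subst-var-< {j} {s} {k} k<j with k ≡ᵇ j in eq₁
... | true = ⊥-elim (<⇒≢ k<j (≡ᵇ⇒≡ k j (≡-subst T (sym eq₁) tt)))
... | false with k <ᵇ j in eq₂
...   | true  = refl
...   | false = ⊥-elim (≡-subst T eq₂ (<⇒<ᵇ k<j))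

subst-var-> : ∀ {j s k} → j < k → subst j s (var k) ≡ var (pred k)
subst-var-> {j} {s} {k} j<k with k ≡ᵇ j in eq₁
... | true = ⊥-elim (<⇒≢ j<k (sym (≡ᵇ⇒≡ k j (≡-subst T (sym eq₁) tt))))
... | false with k <ᵇ j in eq₂
...   | true  = ⊥-elim (<⇒≯ j<k (<ᵇ⇒< k j (≡-subst T (sym eq₂) tt)))
...   | false = refl

Closed : ℕ → Proc → Set
Closed k 𝟘       = ⊤
Closed k 𝟙       = ⊤
Closed k (μ ∙ p) = Closed k p
Closed k (p ⊕ q) = Closed k p × Closed k q
Closed k (var m) = m < k
Closed k (rec p) = Closed (suc k) p

Closed-mono : ∀ {k m} p → k ≤ m → Closed k p → Closed m p
Closed-mono 𝟘       k≤m _          = tt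
Closed-mono 𝟙       k≤m _          = tt
Closed-mono (μ ∙ p) k≤m cp         = Closed-mono p k≤m cp
Closed-mono (p ⊕ q) k≤m (cp , cq)  = Closed-mono p k≤m cp , Closed-mono q k≤m cq
Closed-mono (var m) k≤m m<k        = <-≤-trans m<k k≤m
Closed-mono (rec p) k≤m cp         = Closed-mono p (s≤s k≤m) cp

shift-closed : ∀ {k c} p → k ≤ c → Closed k p → shift c p ≡ p
shift-closed 𝟘       k≤c _         = refl
shift-closed 𝟙       k≤c _         = refl
shift-closed (μ ∙ p) k≤c cp        = cong (μ ∙_) (shift-closed p k≤c cp)
shift-closed (p ⊕ q) k≤c (cp , cq) = cong₂ _⊕_ (shift-closed p k≤c cp) (shift-closed q k≤c cq)
shift-closed (var m) k≤c m<k       = shift-var-< (<-≤-trans m<k k≤c)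
shift-closed (rec p) k≤c cp        = cong rec (shift-closed p (s≤s k≤c) cp)

subst-closed : ∀ {k j} s p → k ≤ j → Closed k p → subst j s p ≡ p
subst-closed s 𝟘       k≤j _         = refl
subst-closed s 𝟙       k≤j _         = refl
subst-closed s (μ ∙ p) k≤j cp        = cong (μ ∙_) (subst-closed s p k≤j cp)
subst-closed s (p ⊕ q) k≤j (cp , cq) = cong₂ _⊕_ (subst-closed s p k≤j cp) (subst-closed s q k≤j cq)
subst-closed s (var m) k≤j m<k       = subst-var-< (<-≤-trans m<k k≤j)
subst-closed s (rec p) k≤j cp        = cong rec (subst-closed (shift 0 s) p (s≤s k≤j) cp)

shift-closed₀ : ∀ {c} s → Closed 0 s → shift c s ≡ s
shift-closed₀ s cs = shift-closed s z≤n cs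

subst-closed₀ : ∀ {j} x s → Closed 0 s → subst j x s ≡ s
subst-closed₀ x s cs = subst-closed x s z≤n cs

subst-shift-var-≥ : ∀ s → Closed 0 s → ∀ {c j k} → c ≤ k → c ≤ j →
  subst (suc j) s (shift c (var k)) ≡ shift c (subst j s (var k))
subst-shift-var-≥ s cs {c} {j} {k} c≤k c≤j rewrite shift-var-≥ c≤k with <-cmp k j
... | tri< k<j _ _ rewrite subst-var-< {suc j} {s} (s≤s k<j) | subst-var-< {j} {s} k<j | shift-var-≥ c≤k = refl
... | tri≈ _ refl _ rewrite subst-var-≡ {suc k} {s} | subst-var-≡ {k} {s} = sym (shift-closed₀ s cs)
subst-shift-var-≥ s cs {c} {j} {suc k} c≤k c≤j | tri> _ _ j<k
  rewrite subst-var-> {suc j} {s} (s≤s j<k) | subst-var-> {j} {s} j<k =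
    sym (shift-var-≥ (≤-trans c≤j (pred-mono-≤ j<k)))

subst-shift : ∀ s → Closed 0 s → ∀ r {c j} → c ≤ j →
  subst (suc j) s (shift c r) ≡ shift c (subst j s r)
subst-shift s cs 𝟘        c≤j = refl
subst-shift s cs 𝟙        c≤j = refl
subst-shift s cs (μ ∙ r)  c≤j = cong (μ ∙_) (subst-shift s cs r c≤j)
subst-shift s cs (r ⊕ r') c≤j = cong₂ _⊕_ (subst-shift s cs r c≤j) (subst-shift s cs r' c≤j)
subst-shift s cs (rec r) {c} {j} c≤j = cong rec (begin
    subst (suc (suc j)) (shift 0 s) (shift (suc c) r)
      ≡⟨ cong (λ z → subst (suc (suc j)) z (shift (suc c) r)) (shift-closed₀ s cs) ⟩
    subst (suc (suc j)) s (shift (suc c) r)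
      ≡⟨ subst-shift s cs r (s≤s c≤j) ⟩
    shift (suc c) (subst (suc j) s r)
      ≡⟨ cong (λ z → shift (suc c) (subst (suc j) z r)) (sym (shift-closed₀ s cs)) ⟩
    shift (suc c) (subst (suc j) (shift 0 s) r)
      ∎)
  where open ≡-Reasoning
subst-shift s cs (var k) {c} {j} c≤j with <-cmp k c
... | tri< k<c _ _ = begin
    subst (suc j) s (shift c (var k))  ≡⟨ cong (subst (suc j) s) (shift-var-< k<c) ⟩
    subst (suc j) s (var k)            ≡⟨ subst-var-< (m≤n⇒m≤1+n (<-≤-trans k<c c≤j)) ⟩
    var k                              ≡⟨ sym (shift-var-< k<c) ⟩
    shift c (var k)                    ≡⟨ cong (shift c) (sym (subst-var-< (<-≤-trans k<c c≤j))) ⟩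
    shift c (subst j s (var k))        ∎
  where open ≡-Reasoning
... | tri≈ _ refl _ = subst-shift-var-≥ s cs ≤-refl c≤j
... | tri> _ _ c<k   = subst-shift-var-≥ s cs (<⇒≤ c<k) c≤j

subst-subst-var : ∀ s → Closed 0 s → ∀ r {i j} k → i ≤ j →
  subst j s (subst i r (var k)) ≡ subst i (subst j s r) (subst (suc j) s (var k))
subst-subst-var s cs r {i} {j} k i≤j with <-cmp k i
... | tri< k<i _ _
  rewrite subst-var-< {i} {r} k<i | subst-var-< {j} {s} (<-≤-trans k<i i≤j)
        | subst-var-< {suc j} {s} (m≤n⇒m≤1+n (<-≤-trans k<i i≤j)) | subst-var-< {i} {subst j s r} k<i = refl
... | tri≈ _ refl _
  rewrite subst-var-≡ {k} {r} | subst-var-< {suc j} {s} (s≤s i≤j) | subst-var-≡ {k} {subst j s r} = refl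
subst-subst-var s cs r {i} {j} (suc k) i≤j | tri> _ _ i<k with <-cmp k j
... | tri< k<j _ _
  rewrite subst-var-> {i} {r} i<k | subst-var-< {j} {s} k<j | subst-var-< {suc j} {s} (s≤s k<j)
        | subst-var-> {i} {subst j s r} i<k = refl
... | tri≈ _ refl _
  rewrite subst-var-> {i} {r} i<k | subst-var-≡ {k} {s} | subst-var-≡ {suc k} {s} = sym (subst-closed₀ _ s cs)
subst-subst-var s cs r {i} {j} (suc (suc k)) i≤j | tri> _ _ i<k | tri> _ _ j<k
  rewrite subst-var-> {i} {r} i<k | subst-var-> {j} {s} j<k | subst-var-> {suc j} {s} (s≤s j<k)
        | subst-var-> {i} {subst j s r} (≤-<-trans i≤j j<k) = refl

subst-subst : ∀ s → Closed 0 s → ∀ r q {i j} → i ≤ j →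
  subst j s (subst i r q) ≡ subst i (subst j s r) (subst (suc j) s q)
subst-subst s cs r 𝟘        i≤j = refl
subst-subst s cs r 𝟙        i≤j = refl
subst-subst s cs r (μ ∙ q)  i≤j = cong (μ ∙_) (subst-subst s cs r q i≤j)
subst-subst s cs r (q ⊕ q') i≤j = cong₂ _⊕_ (subst-subst s cs r q i≤j) (subst-subst s cs r q' i≤j)
subst-subst s cs r (var k)  i≤j = subst-subst-var s cs r k i≤j
subst-subst s cs r (rec q) {i} {j} i≤j = cong rec (begin
    subst (suc j) (shift 0 s) (subst (suc i) (shift 0 r) q)
      ≡⟨ cong (λ z → subst (suc j) z (subst (suc i) (shift 0 r) q)) (shift-closed₀ s cs) ⟩
    subst (suc j) s (subst (suc i) (shift 0 r) q)
      ≡⟨ subst-subst s cs (shift 0 r) q (s≤s i≤j) ⟩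
    subst (suc i) (subst (suc j) s (shift 0 r)) (subst (suc (suc j)) s q)
      ≡⟨ cong₂ (λ a b → subst (suc i) a (subst (suc (suc j)) b q)) (subst-shift s cs r z≤n) (sym (shift-closed₀ s cs)) ⟩
    subst (suc i) (shift 0 (subst j s r)) (subst (suc (suc j)) (shift 0 s) q) ∎)
  where open ≡-Reasoning

Closed-subst : ∀ x → Closed 0 x → ∀ u {k j} → j ≤ k → Closed (suc k) u → Closed k (subst j x u)
Closed-subst x cx 𝟘       j≤k _         = tt
Closed-subst x cx 𝟙       j≤k _         = tt
Closed-subst x cx (μ ∙ u) j≤k cu        = Closed-subst x cx u j≤k cu
Closed-subst x cx (u ⊕ v) j≤k (cu , cv) = Closed-subst x cx u j≤k cu , Closed-subst x cx v j≤k cv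
Closed-subst x cx (rec u) j≤k cu rewrite shift-closed₀ {0} x cx = Closed-subst x cx u (s≤s j≤k) cu
Closed-subst x cx (var m) {k} {j} j≤k cm with <-cmp m j
... | tri< m<j _ _ rewrite subst-var-< {j} {x} m<j = <-≤-trans m<j j≤k
... | tri≈ _ refl _ rewrite subst-var-≡ {m} {x} = Closed-mono x z≤n cx
Closed-subst x cx (var (suc m)) {k} {j} j≤k (s≤s cm) | tri> _ _ j<m rewrite subst-var-> {j} {x} j<m = cm

-- With j = 0 this closes u in the environment φ, innermost binder first.
substs : List Proc → ℕ → Proc → Proc
substs []      j u = u
substs (x ∷ φ) j u = substs φ j (subst j x u)

substs-∙ : ∀ φ j μ u → substs φ j (μ ∙ u) ≡ μ ∙ substs φ j u
substs-∙ []      j μ u = refl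
substs-∙ (x ∷ φ) j μ u = substs-∙ φ j μ (subst j x u)

substs-⊕ : ∀ φ j u v → substs φ j (u ⊕ v) ≡ substs φ j u ⊕ substs φ j v
substs-⊕ []      j u v = refl
substs-⊕ (x ∷ φ) j u v = substs-⊕ φ j (subst j x u) (subst j x v)

substs-𝟘 : ∀ φ j → substs φ j 𝟘 ≡ 𝟘
substs-𝟘 []      j = refl
substs-𝟘 (x ∷ φ) j = substs-𝟘 φ j

substs-𝟙 : ∀ φ j → substs φ j 𝟙 ≡ 𝟙
substs-𝟙 []      j = refl
substs-𝟙 (x ∷ φ) j = substs-𝟙 φ j

substs-rec : ∀ φ → All (Closed 0) φ → ∀ j u → substs φ j (rec u) ≡ rec (substs φ (suc j) u)
substs-rec []      _         j u = refl
substs-rec (x ∷ φ) (cx ∷ cφ) j u rewrite shift-closed₀ {0} x cx = substs-rec φ cφ j (subst (suc j) x u)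

substs-closed : ∀ φ j u → Closed 0 u → substs φ j u ≡ u
substs-closed []      j u cu = refl
substs-closed (x ∷ φ) j u cu rewrite subst-closed₀ {j} x u cu = substs-closed φ j u cu

subst-substs : ∀ X → Closed 0 X → ∀ φ → All (Closed 0) φ → ∀ j u →
  subst j X (substs φ (suc j) u) ≡ substs φ j (subst j X u)
subst-substs X cX []      _         j u = refl
subst-substs X cX (y ∷ φ) (cy ∷ cφ) j u = begin
    subst j X (substs φ (suc j) (subst (suc j) y u))
      ≡⟨ subst-substs X cX φ cφ j (subst (suc j) y u) ⟩
    substs φ j (subst j X (subst (suc j) y u))
      ≡⟨ cong (λ z → substs φ j (subst j z (subst (suc j) y u))) (sym (subst-closed₀ {j} y X cX)) ⟩
    substs φ j (subst j (subst j y X) (subst (suc j) y u))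
      ≡⟨ cong (substs φ j) (sym (subst-subst y cy X u ≤-refl)) ⟩
    substs φ j (subst j y (subst j X u))
      ∎
  where open ≡-Reasoning

Closed-substs : ∀ φ → All (Closed 0) φ → ∀ u → Closed (length φ) u → Closed 0 (substs φ 0 u)
Closed-substs []      _         u cu = cu
Closed-substs (x ∷ φ) (cx ∷ cφ) u cu = Closed-substs φ cφ (subst 0 x u) (Closed-subst x cx u z≤n cu)

substs-unfold : ∀ φ → All (Closed 0) φ → ∀ q → Closed (length φ) (rec q) →
  subst 0 (rec (substs φ 1 q)) (substs φ 1 q) ≡ substs (substs φ 0 (rec q) ∷ φ) 0 q
substs-unfold φ cφ q cq = begin
  subst 0 (rec (substs φ 1 q)) (substs φ 1 q)  ≡⟨ subst-substs (rec (substs φ 1 q)) closed-unfolding φ cφ 0 q ⟩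
  substs φ 0 (subst 0 (rec (substs φ 1 q)) q)  ≡⟨ cong (λ z → substs φ 0 (subst 0 z q)) (sym (substs-rec φ cφ 0 q)) ⟩
  substs φ 0 (subst 0 (substs φ 0 (rec q)) q)  ∎
  where
  open ≡-Reasoning
  closed-unfolding : Closed 0 (rec (substs φ 1 q))
  closed-unfolding = ≡-subst (Closed 0) (substs-rec φ cφ 0 q) (Closed-substs φ cφ (rec q) cq)

lookup? : ∀ {A : Set} → List A → ℕ → Maybe A
lookup? []       k       = nothing
lookup? (x ∷ xs) zero    = just x
lookup? (x ∷ xs) (suc k) = lookup? xs k

lookup?-map : ∀ {A B : Set} (f : A → B) xs k → lookup? (map f xs) k ≡ Maybe.map f (lookup? xs k)
lookup?-map f []       k       = refl
lookup?-map f (x ∷ xs) zero    = refl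
lookup?-map f (x ∷ xs) (suc k) = lookup?-map f xs k

lookup?-All : ∀ {A : Set} {P : A → Set} {xs k x} → All P xs → lookup? xs k ≡ just x → P x
lookup?-All {k = zero}  (px ∷ _)  refl = px
lookup?-All {k = suc k} (_  ∷ ps) e    = lookup?-All ps e

substs-var-just : ∀ φ → All (Closed 0) φ → ∀ k {x} → lookup? φ k ≡ just x → substs φ 0 (var k) ≡ x
substs-var-just (y ∷ φ) (cy ∷ cφ) zero    refl = substs-closed φ 0 y cy
substs-var-just (y ∷ φ) (cy ∷ cφ) (suc k) e    = substs-var-just φ cφ k e

substs-var-nothing : ∀ φ k → lookup? φ k ≡ nothing → ∃ λ m → substs φ 0 (var k) ≡ var m
substs-var-nothing []      k       e  = k , refl
substs-var-nothing (y ∷ φ) zero    ()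
substs-var-nothing (y ∷ φ) (suc k) e  = substs-var-nothing φ k e

rec-injective : ∀ {a b} → rec a ≡ rec b → a ≡ b
rec-injective refl = refl

-- Bisimilarity and must testing

record LTS : Set₁ where
  field
    States : Set
    Tr     : States → Lab → States → Set
open LTS public

Succeeds : (A : LTS) → States A → Set
Succeeds A s = ∃ λ s' → Tr A s ✓ s'

-- Strong bisimulation for the μ-moves.
record IsBisimulation (A B : LTS) (R : States A → States B → Set) : Set where
  field
    forth   : ∀ {x y μ x'} → R x y → Tr A x (pre μ) x' → ∃ λ y' → Tr B y (pre μ) y' × R x' y'
    back    : ∀ {x y μ y'} → R x y → Tr B y (pre μ) y' → ∃ λ x' → Tr A x (pre μ) x' × R x' y'
    ✓-forth : ∀ {x y} → R x y → Succeeds A x → Succeeds B y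
    ✓-back  : ∀ {x y} → R x y → Succeeds B y → Succeeds A x
open IsBisimulation public

Bisimilar : (A B : LTS) → States A → States B → Set₁
Bisimilar A B x y = Σ (States A → States B → Set) λ R → IsBisimulation A B R × R x y

bisim-refl : ∀ {A} x → Bisimilar A A x x
bisim-refl x = _≡_ , record
  { forth = λ { refl t → _ , t , refl } ; back = λ { refl t → _ , t , refl }
  ; ✓-forth = λ { refl o → o } ; ✓-back = λ { refl o → o } } , refl

bisim-sym : ∀ {A B x y} → Bisimilar A B x y → Bisimilar B A y x
bisim-sym (R , b , r) = (λ y x → R x y) ,
  record { forth = back b ; back = forth b ; ✓-forth = ✓-back b ; ✓-back = ✓-forth b } , r

bisim-trans : ∀ {A B C x y z} → Bisimilar A B x y → Bisimilar B C y z → Bisimilar A C x z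
bisim-trans {A} {B} {C} (R , b , r) (S , c , s) = (λ x z → ∃ λ y → R x y × S y z) , record
  { forth   = λ { (y , r , s) t → let (y' , t₁ , r') = forth b r t ; (z' , t₂ , s') = forth c s t₁ in z' , t₂ , (y' , r' , s') }
  ; back    = λ { (y , r , s) t → let (y' , t₁ , s') = back c s t ; (x' , t₂ , r') = back b r t₁ in x' , t₂ , (y' , r' , s') }
  ; ✓-forth = λ { (y , r , s) o → ✓-forth c s (✓-forth b r o) }
  ; ✓-back  = λ { (y , r , s) o → ✓-back b r (✓-back c s o) } } , (_ , r , s)

ConfLTS : LTS
ConfLTS = record { States = Conf ; Tr = _═[_]⇒_ }

infix 4 _≈_
_≈_ : Conf → Conf → Set₁
_≈_ = Bisimilar ConfLTS ConfLTS

≈-refl : ∀ {c} → c ≈ c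
≈-refl = bisim-refl _

≈-sym : ∀ {c d} → c ≈ d → d ≈ c
≈-sym = bisim-sym

≈-trans : ∀ {c d e} → c ≈ d → d ≈ e → c ≈ e
≈-trans = bisim-trans

≈-setoid : Setoid 0ℓ (lsuc 0ℓ)
≈-setoid = record
  { Carrier = Conf ; _≈_ = _≈_
  ; isEquivalence = record { refl = ≈-refl ; sym = ≈-sym ; trans = ≈-trans } }

≡⇒≈ : ∀ {c d} → c ≡ d → c ≈ d
≡⇒≈ {c} refl = bisim-refl c

module _ {R : Conf → Conf → Set} (B : IsBisimulation ConfLTS ConfLTS R) where

  τ-back : ∀ {c d e c' e'} → R d e → (c ∥ e) ═[ pre τ ]⇒ (c' ∥ e') →
    ∃ λ d' → R d' e' × (c ∥ d) ═[ pre τ ]⇒ (c' ∥ d')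
  τ-back r (parL t)    = _ , r , parL t
  τ-back r (parR t)    = let (d' , t' , r') = back B r t in d' , r' , parR t'
  τ-back r (sync t₁ t₂) = let (d' , t' , r') = back B r t₂ in d' , r' , sync t₁ t'

  τ-forth : ∀ {c d e c' d'} → R d e → (c ∥ d) ═[ pre τ ]⇒ (c' ∥ d') →
    ∃ λ e' → (c ∥ e) ═[ pre τ ]⇒ (c' ∥ e')
  τ-forth r (parL t)    = _ , parL t
  τ-forth r (parR t)    = let (e' , t' , _) = forth B r t in e' , parR t'
  τ-forth r (sync t₁ t₂) = let (e' , t' , _) = forth B r t₂ in e' , sync t₁ t'

  -- A computation of p ∥ e is pulled back, state by state, to one of p ∥ d.
  module PullInfinite {p d e} (r₀ : R d e) (κ : InfComp (⟨ p ⟩ , e)) where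
    open InfComp κ

    partner : (i : ℕ) → Σ Conf λ d' → R d' (proj₂ (seq i))
    partner zero    = d , ≡-subst (R d) (sym (cong proj₂ start)) r₀
    partner (suc i) = let (d' , r' , _) = τ-back (proj₂ (partner i)) (steps i) in d' , r'

    pulled : InfComp (⟨ p ⟩ , d)
    pulled = record
      { seq   = λ i → proj₁ (seq i) , proj₁ (partner i)
      ; start = cong (λ z → z , d) (cong proj₁ start)
      ; steps = λ i → proj₂ (proj₂ (τ-back (proj₂ (partner i)) (steps i))) }

  module PullMaximal {p d e} (r₀ : R d e) (κ : FinMaxComp (⟨ p ⟩ , e)) where
    open FinMaxComp κ

    -- Beyond len the partner is junk; relatedness is only claimed up to len.
    partner : (i : ℕ) → Σ Conf λ d' → i ≤ len → R d' (proj₂ (seq i))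
    partner zero = d , λ _ → ≡-subst (R d) (sym (cong proj₂ start)) r₀
    partner (suc i) with suc i ≤? len
    ... | yes i<len = let (d' , r' , _) = τ-back (proj₂ (partner i) (≤-trans (n≤1+n i) i<len)) (steps i i<len)
                      in d' , λ _ → r'
    ... | no  i≮len = proj₁ (partner i) , λ i<len → ⊥-elim (i≮len i<len)

    pulled-step : ∀ i → i < len →
      Step (proj₁ (seq i) , proj₁ (partner i)) (proj₁ (seq (suc i)) , proj₁ (partner (suc i)))
    pulled-step i i<len with suc i ≤? len
    ... | yes i<len' = proj₂ (proj₂ (τ-back (proj₂ (partner i) (≤-trans (n≤1+n i) i<len')) (steps i i<len')))
    ... | no  i≮len  = ⊥-elim (i≮len i<len)

    pulled : FinMaxComp (⟨ p ⟩ , d)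
    pulled = record
      { len   = len
      ; seq   = λ i → proj₁ (seq i) , proj₁ (partner i)
      ; start = cong (λ z → z , d) (cong proj₁ start)
      ; steps = pulled-step
      ; stuck = λ { (c' , d') t → let (e' , t') = τ-forth (proj₂ (partner len) ≤-refl) t in stuck (c' , e') t' } }

must-≈ : ∀ {p d e} → d ≈ e → p must d → p must e
must-≈ (R , B , r₀) (must-inf , must-max) =
  (λ κ → let open PullInfinite B r₀ κ ; (j , ok) = must-inf pulled in
         j , ✓-forth B (proj₂ (partner j)) ok) ,
  (λ κ → let open PullMaximal B r₀ κ ; (j , j≤len , ok) = must-max pulled in
         j , j≤len , ✓-forth B (proj₂ (partner j) j≤len) ok)

-- Parallel composition up to bisimilarity

bar-involutive : ∀ α → bar (bar α) ≡ α
bar-involutive (nm a) = refl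
bar-involutive (co a) = refl

data Par (R₁ R₂ : Conf → Conf → Set) : Conf → Conf → Set where
  par : ∀ {a a' b b'} → R₁ a a' → R₂ b b' → Par R₁ R₂ (a ∥ b) (a' ∥ b')

∥-cong : ∀ {a a' b b'} → a ≈ a' → b ≈ b' → (a ∥ b) ≈ (a' ∥ b')
∥-cong (R₁ , B₁ , r₁) (R₂ , B₂ , r₂) =
  Par R₁ R₂ , record { forth = fwd ; back = bwd ; ✓-forth = ok-fwd ; ✓-back = ok-bwd } , par r₁ r₂
  where
  fwd : ∀ {x y μ x'} → Par R₁ R₂ x y → x ═[ pre μ ]⇒ x' → ∃ λ y' → y ═[ pre μ ]⇒ y' × Par R₁ R₂ x' y'
  fwd (par r s) (parL t) = let (_ , t' , r') = forth B₁ r t in _ , parL t' , par r' s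
  fwd (par r s) (parR t) = let (_ , t' , s') = forth B₂ s t in _ , parR t' , par r s'
  fwd (par r s) (sync t₁ t₂) =
    let (_ , t₁' , r') = forth B₁ r t₁ ; (_ , t₂' , s') = forth B₂ s t₂ in _ , sync t₁' t₂' , par r' s'
  bwd : ∀ {x y μ y'} → Par R₁ R₂ x y → y ═[ pre μ ]⇒ y' → ∃ λ x' → x ═[ pre μ ]⇒ x' × Par R₁ R₂ x' y'
  bwd (par r s) (parL t) = let (_ , t' , r') = back B₁ r t in _ , parL t' , par r' s
  bwd (par r s) (parR t) = let (_ , t' , s') = back B₂ s t in _ , parR t' , par r s'
  bwd (par r s) (sync t₁ t₂) =
    let (_ , t₁' , r') = back B₁ r t₁ ; (_ , t₂' , s') = back B₂ s t₂ in _ , sync t₁' t₂' , par r' s'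
  ok-fwd : ∀ {x y} → Par R₁ R₂ x y → Succeeds ConfLTS x → Succeeds ConfLTS y
  ok-fwd (par r s) (_ , both✓ t₁ t₂) =
    let (_ , u₁) = ✓-forth B₁ r (_ , t₁) ; (_ , u₂) = ✓-forth B₂ s (_ , t₂) in _ , both✓ u₁ u₂
  ok-bwd : ∀ {x y} → Par R₁ R₂ x y → Succeeds ConfLTS y → Succeeds ConfLTS x
  ok-bwd (par r s) (_ , both✓ t₁ t₂) =
    let (_ , u₁) = ✓-back B₁ r (_ , t₁) ; (_ , u₂) = ✓-back B₂ s (_ , t₂) in _ , both✓ u₁ u₂

data Reassociated : Conf → Conf → Set where
  reassoc : ∀ {a b c} → Reassociated ((a ∥ b) ∥ c) (a ∥ (b ∥ c))

∥-assoc : ∀ a b c → ((a ∥ b) ∥ c) ≈ (a ∥ (b ∥ c))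
∥-assoc a b c =
  Reassociated , record { forth = fwd ; back = bwd ; ✓-forth = ok-fwd ; ✓-back = ok-bwd } , reassoc
  where
  fwd : ∀ {x y μ x'} → Reassociated x y → x ═[ pre μ ]⇒ x' → ∃ λ y' → y ═[ pre μ ]⇒ y' × Reassociated x' y'
  fwd reassoc (parL (parL t))      = _ , parL t , reassoc
  fwd reassoc (parL (parR t))      = _ , parR (parL t) , reassoc
  fwd reassoc (parL (sync t₁ t₂))  = _ , sync t₁ (parL t₂) , reassoc
  fwd reassoc (parR t)             = _ , parR (parR t) , reassoc
  fwd reassoc (sync (parL t₁) t₃)  = _ , sync t₁ (parR t₃) , reassoc
  fwd reassoc (sync (parR t₂) t₃)  = _ , parR (sync t₂ t₃) , reassoc
  bwd : ∀ {x y μ y'} → Reassociated x y → y ═[ pre μ ]⇒ y' → ∃ λ x' → x ═[ pre μ ]⇒ x' × Reassociated x' y'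
  bwd reassoc (parL t)             = _ , parL (parL t) , reassoc
  bwd reassoc (parR (parL t))      = _ , parL (parR t) , reassoc
  bwd reassoc (parR (parR t))      = _ , parR t , reassoc
  bwd reassoc (parR (sync t₂ t₃))  = _ , sync (parR t₂) t₃ , reassoc
  bwd reassoc (sync t₁ (parL t₂))  = _ , parL (sync t₁ t₂) , reassoc
  bwd reassoc (sync t₁ (parR t₃))  = _ , sync (parL t₁) t₃ , reassoc
  ok-fwd : ∀ {x y} → Reassociated x y → Succeeds ConfLTS x → Succeeds ConfLTS y
  ok-fwd reassoc (_ , both✓ (both✓ t₁ t₂) t₃) = _ , both✓ t₁ (both✓ t₂ t₃)
  ok-bwd : ∀ {x y} → Reassociated x y → Succeeds ConfLTS y → Succeeds ConfLTS x
  ok-bwd reassoc (_ , both✓ t₁ (both✓ t₂ t₃)) = _ , both✓ (both✓ t₁ t₂) t₃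

data Swapped : Conf → Conf → Set where
  swap : ∀ {a b} → Swapped (a ∥ b) (b ∥ a)

sync-swap : ∀ {c d c' d' α} → c ═[ pre (act α) ]⇒ c' → d ═[ pre (act (bar α)) ]⇒ d' →
  (d ∥ c) ═[ pre τ ]⇒ (d' ∥ c')
sync-swap {α = α} t₁ t₂ = sync t₂ (≡-subst (λ β → _ ═[ pre (act β) ]⇒ _) (sym (bar-involutive α)) t₁)

∥-comm : ∀ a b → (a ∥ b) ≈ (b ∥ a)
∥-comm a b = Swapped , record
  { forth   = swap-step
  ; back    = λ s t → let (x' , t' , s') = swap-step (unswap s) t in x' , t' , unswap s'
  ; ✓-forth = swap-✓
  ; ✓-back  = λ s → swap-✓ (unswap s) } , swap
  where
  unswap : ∀ {x y} → Swapped x y → Swapped y x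
  unswap swap = swap
  swap-step : ∀ {x y μ x'} → Swapped x y → x ═[ pre μ ]⇒ x' → ∃ λ y' → y ═[ pre μ ]⇒ y' × Swapped x' y'
  swap-step swap (parL t)     = _ , parR t , swap
  swap-step swap (parR t)     = _ , parL t , swap
  swap-step swap (sync t₁ t₂) = _ , sync-swap t₁ t₂ , swap
  swap-✓ : ∀ {x y} → Swapped x y → Succeeds ConfLTS x → Succeeds ConfLTS y
  swap-✓ swap (_ , both✓ t₁ t₂) = _ , both✓ t₂ t₁

data Padded : Conf → Conf → Set where
  pad : ∀ {a} → Padded (a ∥ ⟨ 𝟙 ⟩) a

∥-identityʳ : ∀ a → (a ∥ ⟨ 𝟙 ⟩) ≈ a
∥-identityʳ a = Padded , record
  { forth   = fwd
  ; back    = λ { pad t → _ , parL t , pad }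
  ; ✓-forth = λ { pad (_ , both✓ t _) → _ , t }
  ; ✓-back  = λ { pad (_ , t) → _ , both✓ t (lift succ) } } , pad
  where
  fwd : ∀ {x y μ x'} → Padded x y → x ═[ pre μ ]⇒ x' → ∃ λ y' → y ═[ pre μ ]⇒ y' × Padded x' y'
  fwd pad (parL t)            = _ , t , pad
  fwd pad (parR (lift ()))
  fwd pad (sync _ (lift ()))

∥-identityˡ : ∀ a → (⟨ 𝟙 ⟩ ∥ a) ≈ a
∥-identityˡ a = ≈-trans (∥-comm ⟨ 𝟙 ⟩ a) (∥-identityʳ a)

∥-medial : ∀ a b c d → ((a ∥ b) ∥ (c ∥ d)) ≈ ((a ∥ c) ∥ (b ∥ d))
∥-medial a b c d = begin
  (a ∥ b) ∥ (c ∥ d)  ≈⟨ ∥-assoc a b (c ∥ d) ⟩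
  a ∥ (b ∥ (c ∥ d))  ≈⟨ ∥-cong ≈-refl (≈-sym (∥-assoc b c d)) ⟩
  a ∥ ((b ∥ c) ∥ d)  ≈⟨ ∥-cong ≈-refl (∥-cong (∥-comm b c) ≈-refl) ⟩
  a ∥ ((c ∥ b) ∥ d)  ≈⟨ ∥-cong ≈-refl (∥-assoc c b d) ⟩
  a ∥ (c ∥ (b ∥ d))  ≈⟨ ≈-sym (∥-assoc a c (b ∥ d)) ⟩
  (a ∥ c) ∥ (b ∥ d)  ∎
  where open SetoidReasoning ≈-setoid

⨂ : ∀ {k} → (Fin (suc k) → Conf) → Conf
⨂ {zero}  g = g zero
⨂ {suc k} g = g zero ∥ ⨂ (λ i → g (suc i))

parAll≡⨂ : ∀ {k} (o : Fin (suc k) → Proc) → parAll o ≡ ⨂ (λ i → ⟨ o i ⟩)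
parAll≡⨂ {zero}  o = refl
parAll≡⨂ {suc k} o = cong (⟨ o zero ⟩ ∥_) (parAll≡⨂ (λ i → o (suc i)))

⨂-cong : ∀ {k} {g h : Fin (suc k) → Conf} → (∀ i → g i ≈ h i) → ⨂ g ≈ ⨂ h
⨂-cong {zero}  g≈h = g≈h zero
⨂-cong {suc k} g≈h = ∥-cong (g≈h zero) (⨂-cong (λ i → g≈h (suc i)))

⨂-zip : ∀ {k} (g h : Fin (suc k) → Conf) → (⨂ g ∥ ⨂ h) ≈ ⨂ (λ i → g i ∥ h i)
⨂-zip {zero}  g h = ≈-refl
⨂-zip {suc k} g h = begin
  (g zero ∥ ⨂ g⁺) ∥ (h zero ∥ ⨂ h⁺)  ≈⟨ ∥-medial _ _ _ _ ⟩
  (g zero ∥ h zero) ∥ (⨂ g⁺ ∥ ⨂ h⁺)  ≈⟨ ∥-cong ≈-refl (⨂-zip g⁺ h⁺) ⟩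
  (g zero ∥ h zero) ∥ ⨂ (λ i → g⁺ i ∥ h⁺ i) ∎
  where
  open SetoidReasoning ≈-setoid
  g⁺ h⁺ : Fin (suc k) → Conf
  g⁺ i = g (suc i)
  h⁺ i = h (suc i)

⨂-interchange : ∀ {m n} (h : Fin (suc m) → Fin (suc n) → Conf) →
  ⨂ (λ i → ⨂ (λ j → h i j)) ≈ ⨂ (λ j → ⨂ (λ i → h i j))
⨂-interchange {zero}  h = ≈-refl
⨂-interchange {suc m} h = begin
  ⨂ (h zero) ∥ ⨂ (λ i → ⨂ (h (suc i)))                  ≈⟨ ∥-cong ≈-refl (⨂-interchange (λ i → h (suc i))) ⟩
  ⨂ (h zero) ∥ ⨂ (λ j → ⨂ (λ i → h (suc i) j))          ≈⟨ ⨂-zip (h zero) (λ j → ⨂ (λ i → h (suc i) j)) ⟩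
  ⨂ (λ j → h zero j ∥ ⨂ (λ i → h (suc i) j))            ∎
  where open SetoidReasoning ≈-setoid

⨂-𝟙 : ∀ {k} (g : Fin (suc k) → Conf) → (∀ i → g i ≡ ⟨ 𝟙 ⟩) → ⨂ g ≈ ⟨ 𝟙 ⟩
⨂-𝟙 {zero}  g g≡𝟙 = ≡⇒≈ (g≡𝟙 zero)
⨂-𝟙 {suc k} g g≡𝟙 = begin
  g zero ∥ ⨂ (λ i → g (suc i))  ≈⟨ ∥-cong ≈-refl (⨂-𝟙 (λ i → g (suc i)) (λ i → g≡𝟙 (suc i))) ⟩
  g zero ∥ ⟨ 𝟙 ⟩                ≈⟨ ∥-identityʳ _ ⟩
  g zero                        ≈⟨ ≡⇒≈ (g≡𝟙 zero) ⟩
  ⟨ 𝟙 ⟩                         ∎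
  where open SetoidReasoning ≈-setoid

⨂-single : ∀ {k} (g : Fin (suc k) → Conf) i₀ → (∀ i → ¬ i ≡ i₀ → g i ≡ ⟨ 𝟙 ⟩) → ⨂ g ≈ g i₀
⨂-single {zero}  g zero    _ = ≈-refl
⨂-single {suc k} g zero    others = begin
  g zero ∥ ⨂ (λ i → g (suc i))  ≈⟨ ∥-cong ≈-refl (⨂-𝟙 (λ i → g (suc i)) (λ i → others (suc i) (λ ()))) ⟩
  g zero ∥ ⟨ 𝟙 ⟩                ≈⟨ ∥-identityʳ _ ⟩
  g zero                        ∎
  where open SetoidReasoning ≈-setoid
⨂-single {suc k} g (suc i₀) others = begin
  g zero ∥ ⨂ (λ i → g (suc i))  ≈⟨ ∥-cong (≡⇒≈ (others zero (λ ()))) ≈-refl ⟩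
  ⟨ 𝟙 ⟩ ∥ ⨂ (λ i → g (suc i))   ≈⟨ ∥-identityˡ _ ⟩
  ⨂ (λ i → g (suc i))           ≈⟨ ⨂-single (λ i → g (suc i)) i₀ (λ i i≢i₀ → others (suc i) (λ eq → i≢i₀ (suc-injective eq))) ⟩
  g (suc i₀)                    ∎
  where open SetoidReasoning ≈-setoid

step-≡ : ∀ {x y l u} → x ≡ y → x ─[ l ]→ u → y ─[ l ]→ u
step-≡ x≡y = ≡-subst (λ z → z ─[ _ ]→ _) x≡y

var-stuck : ∀ {k l u} → ¬ (var k ─[ l ]→ u)
var-stuck ()

𝟘-stuck : ∀ {l u} → ¬ (𝟘 ─[ l ]→ u)
𝟘-stuck ()

subst𝟘-var : ∀ j k → (subst j 𝟘 (var k) ≡ 𝟘) ⊎ (∃ λ m → subst j 𝟘 (var k) ≡ var m)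
subst𝟘-var j k with <-cmp k j
... | tri< k<j _ _  = inj₂ (_ , subst-var-< k<j)
... | tri≈ _ refl _ = inj₁ (subst-var-≡ {k} {𝟘})
... | tri> _ _ j<k  = inj₂ (_ , subst-var-> j<k)

subst𝟘-step : ∀ j {t l t'} → t ─[ l ]→ t' → subst j 𝟘 t ─[ l ]→ subst j 𝟘 t'
subst𝟘-step j succ     = succ
subst𝟘-step j pref     = pref
subst𝟘-step j (sumL t) = sumL (subst𝟘-step j t)
subst𝟘-step j (sumR t) = sumR (subst𝟘-step j t)
subst𝟘-step j {rec p} (unf t) =
  unf (step-≡ (subst-subst 𝟘 tt (rec p) p z≤n) (subst𝟘-step j t))

subst𝟘-step⁻ : ∀ j t {x l u} → x ≡ subst j 𝟘 t → x ─[ l ]→ u → ∃ λ t' → t ─[ l ]→ t' × u ≡ subst j 𝟘 t'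
subst𝟘-step⁻ j 𝟘       refl ()
subst𝟘-step⁻ j 𝟙       refl succ     = _ , succ , refl
subst𝟘-step⁻ j (μ ∙ p) refl pref     = _ , pref , refl
subst𝟘-step⁻ j (p ⊕ q) refl (sumL t) = let (t' , s , e) = subst𝟘-step⁻ j p refl t in t' , sumL s , e
subst𝟘-step⁻ j (p ⊕ q) refl (sumR t) = let (t' , s , e) = subst𝟘-step⁻ j q refl t in t' , sumR s , e
subst𝟘-step⁻ j (var k) x≡ t with subst𝟘-var j k
... | inj₁ e       = ⊥-elim (𝟘-stuck (step-≡ (trans x≡ e) t))
... | inj₂ (m , e) = ⊥-elim (var-stuck (step-≡ (trans x≡ e) t))
subst𝟘-step⁻ j (rec p) refl (unf t) =
  let (t' , s , e) = subst𝟘-step⁻ j (subst 0 (rec p) p) (sym (subst-subst 𝟘 tt (rec p) p z≤n)) t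
  in t' , unf s , e

data Subst𝟘Related (j : ℕ) : Conf → Conf → Set where
  related : ∀ t → Subst𝟘Related j ⟨ t ⟩ ⟨ subst j 𝟘 t ⟩

-- Free variables have no moves, and neither has 𝟘.
subst𝟘-≈ : ∀ j t → ⟨ t ⟩ ≈ ⟨ subst j 𝟘 t ⟩
subst𝟘-≈ j t = Subst𝟘Related j , record
  { forth   = λ { (related t) (lift s) → _ , lift (subst𝟘-step j s) , related _ }
  ; back    = bwd
  ; ✓-forth = λ { (related t) (_ , lift s) → _ , lift (subst𝟘-step j s) }
  ; ✓-back  = λ { (related t) (_ , lift s) → let (_ , s' , _) = subst𝟘-step⁻ j t refl s in _ , lift s' } }
  , related t
  where
  bwd : ∀ {x y μ y'} → Subst𝟘Related j x y → y ═[ pre μ ]⇒ y' → ∃ λ x' → x ═[ pre μ ]⇒ x' × Subst𝟘Related j x' y'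
  bwd (related t) (lift s) with subst𝟘-step⁻ j t refl s
  ... | t' , s' , refl = _ , lift s' , related t'

fvBound : Proc → ℕ
fvBound 𝟘       = 0
fvBound 𝟙       = 0
fvBound (μ ∙ p) = fvBound p
fvBound (p ⊕ q) = fvBound p ⊔ fvBound q
fvBound (var k) = suc k
fvBound (rec p) = pred (fvBound p)

Closed-fvBound : ∀ p → Closed (fvBound p) p
Closed-fvBound 𝟘       = tt
Closed-fvBound 𝟙       = tt
Closed-fvBound (μ ∙ p) = Closed-fvBound p
Closed-fvBound (p ⊕ q) = Closed-mono p (m≤m⊔n _ _) (Closed-fvBound p) , Closed-mono q (m≤n⊔m _ _) (Closed-fvBound q)
Closed-fvBound (var k) = ≤-refl
Closed-fvBound (rec p) = Closed-mono p (≤-suc-pred (fvBound p)) (Closed-fvBound p)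
  where
  ≤-suc-pred : ∀ n → n ≤ suc (pred n)
  ≤-suc-pred zero    = z≤n
  ≤-suc-pred (suc n) = ≤-refl

close𝟘 : ℕ → Proc → Proc
close𝟘 zero    p = p
close𝟘 (suc m) p = close𝟘 m (subst 0 𝟘 p)

Closed-close𝟘 : ∀ m p → Closed m p → Closed 0 (close𝟘 m p)
Closed-close𝟘 zero    p cp = cp
Closed-close𝟘 (suc m) p cp = Closed-close𝟘 m (subst 0 𝟘 p) (Closed-subst 𝟘 tt p z≤n cp)

close𝟘-≈ : ∀ m p → ⟨ p ⟩ ≈ ⟨ close𝟘 m p ⟩
close𝟘-≈ zero    p = ≈-refl
close𝟘-≈ (suc m) p = ≈-trans (subst𝟘-≈ 0 p) (close𝟘-≈ m (subst 0 𝟘 p))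

close : Proc → Proc
close p = close𝟘 (fvBound p) p

Closed-close : ∀ p → Closed 0 (close p)
Closed-close p = Closed-close𝟘 (fvBound p) p (Closed-fvBound p)

close-≈ : ∀ p → ⟨ p ⟩ ≈ ⟨ close p ⟩
close-≈ p = close𝟘-≈ (fvBound p) p

∈n-subst𝟘 : ∀ j t {a} → a ∈n subst j 𝟘 t → a ∈n t
∈n-subst𝟘 j 𝟘 ()
∈n-subst𝟘 j 𝟙 ()
∈n-subst𝟘 j (act (nm b) ∙ t) here-nm   = here-nm
∈n-subst𝟘 j (act (co b) ∙ t) here-co   = here-co
∈n-subst𝟘 j (μ ∙ t)          (there a∈) = there (∈n-subst𝟘 j t a∈)
∈n-subst𝟘 j (t ⊕ u)          (inL a∈)   = inL (∈n-subst𝟘 j t a∈)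
∈n-subst𝟘 j (t ⊕ u)          (inR a∈)   = inR (∈n-subst𝟘 j u a∈)
∈n-subst𝟘 j (rec t)          (inRec a∈) = inRec (∈n-subst𝟘 (suc j) t a∈)
∈n-subst𝟘 j (var k) a∈ with subst𝟘-var j k
... | inj₁ e       = ⊥-elim (∉𝟘 (≡-subst (_ ∈n_) e a∈))
  where
  ∉𝟘 : ∀ {a} → ¬ (a ∈n 𝟘)
  ∉𝟘 ()
... | inj₂ (m , e) = ⊥-elim (∉var (≡-subst (_ ∈n_) e a∈))
  where
  ∉var : ∀ {a m} → ¬ (a ∈n var m)
  ∉var ()

∈n-close𝟘 : ∀ m p {a} → a ∈n close𝟘 m p → a ∈n p
∈n-close𝟘 zero    p a∈ = a∈
∈n-close𝟘 (suc m) p a∈ = ∈n-subst𝟘 0 p (∈n-close𝟘 m (subst 0 𝟘 p) a∈)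

∈n-close : ∀ p {a} → a ∈n close p → a ∈n p
∈n-close p = ∈n-close𝟘 (fvBound p) p


data Node (V : Set) : Set where
  nil one : Node V
  pfx     : Pre → V → Node V
  ch      : V → V → Node V
  jmp     : V → Node V

record Graph : Set₁ where
  field
    Vertex : Set
    node   : Vertex → Node Vertex
open Graph public

-- A vertex moves as its node does; jmp is a silent indirection (it models
-- unfolding), so a vertex on a jmp-cycle without prefixes has no moves.
data NodeStep (g : Graph) : Node (Vertex g) → Lab → Vertex g → Set
data GStep (g : Graph) (s : Vertex g) (l : Lab) (t : Vertex g) : Set where
  at : NodeStep g (node g s) l t → GStep g s l t

data NodeStep g where
  one✓ : ∀ {t}       → NodeStep g one ✓ t
  pfx→ : ∀ {μ t}     → NodeStep g (pfx μ t) (pre μ) t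
  chL  : ∀ {a b l t} → GStep g a l t → NodeStep g (ch a b) l t
  chR  : ∀ {a b l t} → GStep g b l t → NodeStep g (ch a b) l t
  jmp→ : ∀ {a l t}   → GStep g a l t → NodeStep g (jmp a) l t

along : ∀ {g s n l t} → node g s ≡ n → NodeStep g n l t → GStep g s l t
along refl ns = at ns

_occursIn_ : Name → Pre → Set
a occursIn act (nm b) = a ≡ b
a occursIn act (co b) = a ≡ b
a occursIn τ          = ⊥

occursIn⇒∈n : ∀ {a μ p} → a occursIn μ → a ∈n (μ ∙ p)
occursIn⇒∈n {μ = act (nm b)} refl = here-nm
occursIn⇒∈n {μ = act (co b)} refl = here-co

NodeNames : ∀ {V} → (Name → Set) → Node V → Set
NodeNames P (pfx μ _) = ∀ {a} → a occursIn μ → P a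
NodeNames P _         = ⊤

GraphNames : (Name → Set) → Graph → Set
GraphNames P g = ∀ s → NodeNames P (node g s)

GraphNames-map : ∀ {P Q g} → (∀ {a} → P a → Q a) → GraphNames P g → GraphNames Q g
GraphNames-map {g = g} P⇒Q names s with node g s | names s
... | pfx _ _ | ok = λ a∈ → P⇒Q (ok a∈)
... | nil     | _  = tt
... | one     | _  = tt
... | ch _ _  | _  = tt
... | jmp _   | _  = tt

graphLTS : Graph → LTS
graphLTS g = record { States = Vertex g ; Tr = GStep g }

-- The position graph of a closed process

IsRec : Proc → Set
IsRec x = ∃ λ y → x ≡ rec y

data Pos : Proc → Set where
  root   : ∀ {p}   → Pos p
  pre↓   : ∀ {μ p} → Pos p → Pos (μ ∙ p)
  left↓  : ∀ {p q} → Pos p → Pos (p ⊕ q)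
  right↓ : ∀ {p q} → Pos q → Pos (p ⊕ q)
  body↓  : ∀ {p}   → Pos p → Pos (rec p)

-- The process reached at position i of t when the free variables of t are bound
-- by φ; passing under rec q binds variable 0 to the unfolding rec q itself.
closedAt : (t : Proc) → List Proc → Pos t → Proc
closedAt t       φ root       = substs φ 0 t
closedAt (μ ∙ q) φ (pre↓ i)   = closedAt q φ i
closedAt (q ⊕ r) φ (left↓ i)  = closedAt q φ i
closedAt (q ⊕ r) φ (right↓ i) = closedAt r φ i
closedAt (rec q) φ (body↓ i)  = closedAt q (substs φ 0 (rec q) ∷ φ) i

-- The positions of a closed process p form a graph bisimilar to p: a variable
-- jumps to its binder, a binder jumps to its body.
module PositionGraph (p : Proc) (cp : Closed 0 p) where

  rootNode : (t : Proc) → List (Pos p) → (Pos t → Pos p) → Node (Pos p)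
  rootNode 𝟘       β emb = nil
  rootNode 𝟙       β emb = one
  rootNode (μ ∙ q) β emb = pfx μ (emb (pre↓ root))
  rootNode (q ⊕ r) β emb = ch (emb (left↓ root)) (emb (right↓ root))
  rootNode (var k) β emb = maybe jmp nil (lookup? β k)
  rootNode (rec q) β emb = jmp (emb (body↓ root))

  nodeAt : (t : Proc) → List (Pos p) → (Pos t → Pos p) → Pos t → Node (Pos p)
  nodeAt t       β emb root       = rootNode t β emb
  nodeAt (μ ∙ q) β emb (pre↓ i)   = nodeAt q β (λ j → emb (pre↓ j)) i
  nodeAt (q ⊕ r) β emb (left↓ i)  = nodeAt q β (λ j → emb (left↓ j)) i
  nodeAt (q ⊕ r) β emb (right↓ i) = nodeAt r β (λ j → emb (right↓ j)) i
  nodeAt (rec q) β emb (body↓ i)  = nodeAt q (emb root ∷ β) (λ j → emb (body↓ j)) i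

  graph : Graph
  graph = record { Vertex = Pos p ; node = nodeAt p [] (λ j → j) }

  proc : Pos p → Proc
  proc = closedAt p []

  IsBinder : Pos p → Set
  IsBinder b = ∃ λ c → node graph b ≡ jmp c × (∀ y → proc b ≡ rec y → subst 0 (rec y) y ≡ proc c)

  -- Position i is that of the subterm t, located in p by emb, under the binders
  -- β (innermost first) whose unfoldings are φ.
  record Located (i : Pos p) : Set where
    constructor located
    field
      t         : Proc
      φ         : List Proc
      β         : List (Pos p)
      emb       : Pos t → Pos p
      proc≡     : proc i ≡ substs φ 0 t
      node≡     : node graph i ≡ rootNode t β emb
      closedEnv : All (Closed 0) φ
      recEnv    : All IsRec φ
      env≡      : φ ≡ map proc β
      binders   : All IsBinder β
      proc-emb  : ∀ j → proc (emb j) ≡ closedAt t φ j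
      closed    : Closed (length φ) t
      names⊆    : ∀ {a} → a ∈n t → a ∈n p

  locateIn : ∀ t φ β (emb : Pos t → Pos p) → Closed (length φ) t → All (Closed 0) φ → All IsRec φ →
    φ ≡ map proc β → All IsBinder β → (∀ j → proc (emb j) ≡ closedAt t φ j) →
    (∀ j → node graph (emb j) ≡ nodeAt t β emb j) → (∀ {a} → a ∈n t → a ∈n p) →
    ∀ i → Located (emb i)
  locateIn t φ β emb ct cφ rφ φ≡ bβ pe ne names root = located t φ β emb (pe root) (ne root) cφ rφ φ≡ bβ pe ct names
  locateIn (μ ∙ q) φ β emb ct cφ rφ φ≡ bβ pe ne names (pre↓ i) =
    locateIn q φ β (λ j → emb (pre↓ j)) ct cφ rφ φ≡ bβ (λ j → pe (pre↓ j)) (λ j → ne (pre↓ j)) (λ a∈ → names (there a∈)) i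
  locateIn (q ⊕ r) φ β emb (cq , cr) cφ rφ φ≡ bβ pe ne names (left↓ i) =
    locateIn q φ β (λ j → emb (left↓ j)) cq cφ rφ φ≡ bβ (λ j → pe (left↓ j)) (λ j → ne (left↓ j)) (λ a∈ → names (inL a∈)) i
  locateIn (q ⊕ r) φ β emb (cq , cr) cφ rφ φ≡ bβ pe ne names (right↓ i) =
    locateIn r φ β (λ j → emb (right↓ j)) cr cφ rφ φ≡ bβ (λ j → pe (right↓ j)) (λ j → ne (right↓ j)) (λ a∈ → names (inR a∈)) i
  locateIn (rec q) φ β emb ct cφ rφ φ≡ bβ pe ne names (body↓ i) =
    locateIn q (X ∷ φ) (emb root ∷ β) (λ j → emb (body↓ j)) ct (Closed-substs φ cφ (rec q) ct ∷ cφ)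
      ((_ , substs-rec φ cφ 0 q) ∷ rφ) (cong₂ _∷_ (sym (pe root)) φ≡) (binder ∷ bβ)
      (λ j → pe (body↓ j)) (λ j → ne (body↓ j)) (λ a∈ → names (inRec a∈)) i
    where
    X : Proc
    X = substs φ 0 (rec q)
    binder : IsBinder (emb root)
    binder = emb (body↓ root) , ne root , λ y proc≡rec →
      let q≡y : substs φ 1 q ≡ y
          q≡y = rec-injective (trans (sym (substs-rec φ cφ 0 q)) (trans (sym (pe root)) proc≡rec))
      in trans (cong (λ z → subst 0 (rec z) z) (sym q≡y)) (trans (substs-unfold φ cφ q ct) (sym (pe (body↓ root))))

  locate : ∀ i → Located i
  locate = locateIn p [] [] (λ j → j) cp [] [] refl [] (λ _ → refl) (λ _ → refl) (λ a∈ → a∈)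

  -- Success is only observed, so the state reached by ✓ is left unconstrained.
  Matches : Lab → Proc → Pos p → Set
  Matches (pre μ) u i' = u ≡ proc i'
  Matches ✓       u i' = ⊤

  env-just : ∀ {φ β k b} → φ ≡ map proc β → lookup? β k ≡ just b → lookup? φ k ≡ just (proc b)
  env-just {β = β} {k} refl eb = trans (lookup?-map proc β k) (cong (Maybe.map proc) eb)

  env-nothing : ∀ {φ β k} → φ ≡ map proc β → lookup? β k ≡ nothing → lookup? φ k ≡ nothing
  env-nothing {β = β} {k} refl eb = trans (lookup?-map proc β k) (cong (Maybe.map proc) eb)

  Forth : Pos p → Lab → Proc → Set
  Forth i l u = ∃ λ i' → GStep graph i l i' × Matches l u i'

  mutual
    step⇒graph : ∀ {x l u} → x ─[ l ]→ u → ∀ i → x ≡ proc i → Forth i l u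
    step⇒graph s i x≡ = step⇒graph-at s i (locate i) x≡

    step⇒graph-at : ∀ {x l u} → x ─[ l ]→ u → ∀ i → Located i → x ≡ proc i →
      Forth i l u
    step⇒graph-at s i (located 𝟘 φ β emb p≡ n≡ cφ rφ φ≡ bβ pe ct _) x≡ =
      ⊥-elim (𝟘-stuck (step-≡ (trans x≡ (trans p≡ (substs-𝟘 φ 0))) s))
    step⇒graph-at s i (located 𝟙 φ β emb p≡ n≡ cφ rφ φ≡ bβ pe ct _) x≡ = go s (trans x≡ (trans p≡ (substs-𝟙 φ 0)))
      where
      go : ∀ {x l u} → x ─[ l ]→ u → x ≡ 𝟙 → Forth i l u
      go succ refl = i , along n≡ one✓ , tt
    step⇒graph-at s i (located (μ ∙ q) φ β emb p≡ n≡ cφ rφ φ≡ bβ pe ct _) x≡ = go s (trans x≡ (trans p≡ (substs-∙ φ 0 μ q)))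
      where
      go : ∀ {x l u} → x ─[ l ]→ u → x ≡ μ ∙ substs φ 0 q → Forth i l u
      go pref refl = emb (pre↓ root) , along n≡ pfx→ , sym (pe (pre↓ root))
    step⇒graph-at s i (located (q ⊕ r) φ β emb p≡ n≡ cφ rφ φ≡ bβ pe ct _) x≡ = go s (trans x≡ (trans p≡ (substs-⊕ φ 0 q r)))
      where
      go : ∀ {x l u} → x ─[ l ]→ u → x ≡ substs φ 0 q ⊕ substs φ 0 r → Forth i l u
      go (sumL s') refl = let (i' , g , m) = step⇒graph s' (emb (left↓ root)) (sym (pe (left↓ root)))
        in i' , along n≡ (chL g) , m
      go (sumR s') refl = let (i' , g , m) = step⇒graph s' (emb (right↓ root)) (sym (pe (right↓ root)))
        in i' , along n≡ (chR g) , m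
    step⇒graph-at s i (located (rec q) φ β emb p≡ n≡ cφ rφ φ≡ bβ pe ct _) x≡ =
      let (i' , g , m) = unfold⇒graph s (trans x≡ (trans p≡ (substs-rec φ cφ 0 q))) (emb (body↓ root))
                           (trans (substs-unfold φ cφ q ct) (sym (pe (body↓ root))))
      in i' , along n≡ (jmp→ g) , m
    step⇒graph-at s i (located (var k) φ β emb p≡ n≡ cφ rφ φ≡ bβ pe ct _) x≡ with lookup? β k in eb
    ... | nothing = let (m , var≡) = substs-var-nothing φ k (env-nothing φ≡ eb) in
                    ⊥-elim (var-stuck (step-≡ (trans x≡ (trans p≡ var≡)) s))
    ... | just b =
      let φk≡ = env-just φ≡ eb
          (c , b↦c , b-unfolds) = lookup?-All bβ eb
          (y , b≡rec) = lookup?-All rφ φk≡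
          (i' , g , m) = unfold⇒graph s (trans x≡ (trans p≡ (trans (substs-var-just φ cφ k φk≡) b≡rec))) c (b-unfolds y b≡rec)
      in i' , along n≡ (jmp→ (along b↦c (jmp→ g))) , m

    unfold⇒graph : ∀ {x l u y} → x ─[ l ]→ u → x ≡ rec y → ∀ c → subst 0 (rec y) y ≡ proc c →
      Forth c l u
    unfold⇒graph (unf s) refl c unfolds = step⇒graph s c unfolds

  Back : Pos p → Lab → Pos p → Set
  Back i l i' = ∃ λ u → proc i ─[ l ]→ u × Matches l u i'

  mutual
    graph⇒step : ∀ {i l i'} → GStep graph i l i' → Back i l i'
    graph⇒step {i} g = graph⇒step-at (locate i) g

    graph⇒step-at : ∀ {i l i'} → Located i → GStep graph i l i' → Back i l i'
    graph⇒step-at {i} L (at ns) with node graph i | Located.node≡ L | ns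
    ... | _ | refl | ns' = root⇒step L ns'

    root⇒step : ∀ {i l i'} (L : Located i) → let open Located L in
      NodeStep graph (rootNode t β emb) l i' → Back i l i'
    root⇒step (located 𝟘 φ β emb p≡ n≡ cφ rφ φ≡ bβ pe ct _) ()
    root⇒step (located 𝟙 φ β emb p≡ n≡ cφ rφ φ≡ bβ pe ct _) one✓ =
      𝟘 , step-≡ (sym (trans p≡ (substs-𝟙 φ 0))) succ , tt
    root⇒step (located (μ ∙ q) φ β emb p≡ n≡ cφ rφ φ≡ bβ pe ct _) pfx→ =
      substs φ 0 q , step-≡ (sym (trans p≡ (substs-∙ φ 0 μ q))) pref , sym (pe (pre↓ root))
    root⇒step (located (q ⊕ r) φ β emb p≡ n≡ cφ rφ φ≡ bβ pe ct _) (chL g) =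
      let (u , s , m) = graph⇒step g in
      u , step-≡ (sym (trans p≡ (substs-⊕ φ 0 q r))) (sumL (step-≡ (pe (left↓ root)) s)) , m
    root⇒step (located (q ⊕ r) φ β emb p≡ n≡ cφ rφ φ≡ bβ pe ct _) (chR g) =
      let (u , s , m) = graph⇒step g in
      u , step-≡ (sym (trans p≡ (substs-⊕ φ 0 q r))) (sumR (step-≡ (pe (right↓ root)) s)) , m
    root⇒step (located (rec q) φ β emb p≡ n≡ cφ rφ φ≡ bβ pe ct _) (jmp→ g) =
      let (u , s , m) = graph⇒step g in
      u , step-≡ (sym (trans p≡ (substs-rec φ cφ 0 q)))
            (unf (step-≡ (sym (trans (substs-unfold φ cφ q ct) (sym (pe (body↓ root))))) s)) , m
    root⇒step (located (var k) φ β emb p≡ n≡ cφ rφ φ≡ bβ pe ct _) g with lookup? β k in eb | g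
    ... | just b | jmp→ g' =
      let (u , s , m) = graph⇒step g' in
      u , step-≡ (sym (trans p≡ (substs-var-just φ cφ k (env-just φ≡ eb)))) s , m

  positionGraph-≈ : Bisimilar ConfLTS (graphLTS graph) ⟨ p ⟩ root
  positionGraph-≈ = (λ x i → x ≡ ⟨ proc i ⟩) , record
    { forth   = λ { refl (lift s) → let (i' , g , m) = step⇒graph s _ refl in i' , g , cong ⟨_⟩ m }
    ; back    = λ { refl g → let (u , s , m) = graph⇒step g in ⟨ u ⟩ , lift s , cong ⟨_⟩ m }
    ; ✓-forth = λ { refl (_ , lift s) → let (i' , g , _) = step⇒graph s _ refl in i' , g }
    ; ✓-back  = λ { refl (_ , g) → let (u , s , _) = graph⇒step g in ⟨ u ⟩ , lift s } } , refl

  positionGraph-names : GraphNames (_∈n p) graph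
  positionGraph-names i with locate i
  ... | L with node graph i | Located.node≡ L
  ...   | _ | refl = root-names L
    where
    root-names : ∀ {i} (L : Located i) → let open Located L in NodeNames (_∈n p) (rootNode t β emb)
    root-names (located (μ ∙ q) _ _ _ _ _ _ _ _ _ _ _ names) a∈μ = names (occursIn⇒∈n a∈μ)
    root-names (located 𝟘       _ _ _ _ _ _ _ _ _ _ _ _) = tt
    root-names (located 𝟙       _ _ _ _ _ _ _ _ _ _ _ _) = tt
    root-names (located (_ ⊕ _) _ _ _ _ _ _ _ _ _ _ _ _) = tt
    root-names (located (rec _) _ _ _ _ _ _ _ _ _ _ _ _) = tt
    root-names (located (var k) _ β _ _ _ _ _ _ _ _ _ _) with lookup? β k
    ... | nothing = tt
    ... | just _  = tt

-- The product of two graphs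

_≟ₐ_ : (α β : Act) → Dec (α ≡ β)
nm a ≟ₐ nm b with a ≟ℕ b
... | yes refl = yes refl
... | no  a≢b  = no λ { refl → a≢b refl }
nm a ≟ₐ co b = no λ ()
co a ≟ₐ nm b = no λ ()
co a ≟ₐ co b with a ≟ℕ b
... | yes refl = yes refl
... | no  a≢b  = no λ { refl → a≢b refl }

-- Which part of the product's four-way choice a vertex is exploring; a Fin so
-- that the product of finite graphs is evidently finite.
Tag : Set
Tag = Fin 9

pattern tMain   = zero
pattern tMain₁  = suc zero
pattern tMain₂  = suc (suc zero)
pattern tLeft   = suc (suc (suc zero))
pattern tRight  = suc (suc (suc (suc zero)))
pattern tTick   = suc (suc (suc (suc (suc zero))))
pattern tTick₂  = suc (suc (suc (suc (suc (suc zero)))))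
pattern tSync   = suc (suc (suc (suc (suc (suc (suc zero))))))
pattern tSync₂  = suc (suc (suc (suc (suc (suc (suc (suc zero)))))))

-- The product graph of g₁ and g₂ computes the parallel composition: from
-- (x , y , tMain) it offers a move of x, a move of y, a synchronisation, or a
-- joint ✓. Each alternative walks the choice and jmp structure of x (and
-- then y) in a copy of the vertex set labelled by a tag.
module Product (g₁ g₂ : Graph) where

  V : Set
  V = Vertex g₁ × Vertex g₂ × Tag

  leftNode : Node (Vertex g₁) → Vertex g₂ → Node V
  leftNode (pfx μ x') y = pfx μ (x' , y , tMain)
  leftNode (ch a b)   y = ch (a , y , tLeft) (b , y , tLeft)
  leftNode (jmp a)    y = jmp (a , y , tLeft)
  leftNode nil        y = nil
  leftNode one        y = nil

  rightNode : Vertex g₁ → Node (Vertex g₂) → Node V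
  rightNode x (pfx μ y') = pfx μ (x , y' , tMain)
  rightNode x (ch a b)   = ch (x , a , tRight) (x , b , tRight)
  rightNode x (jmp a)    = jmp (x , a , tRight)
  rightNode x nil        = nil
  rightNode x one        = nil

  tickNode : Vertex g₁ → Node (Vertex g₁) → Vertex g₂ → Node V
  tickNode x one       y = jmp (x , y , tTick₂)
  tickNode x (ch a b)  y = ch (a , y , tTick) (b , y , tTick)
  tickNode x (jmp a)   y = jmp (a , y , tTick)
  tickNode x nil       y = nil
  tickNode x (pfx _ _) y = nil

  tickNode₂ : Vertex g₁ → Node (Vertex g₂) → Node V
  tickNode₂ x one       = one
  tickNode₂ x (ch a b)  = ch (x , a , tTick₂) (x , b , tTick₂)
  tickNode₂ x (jmp a)   = jmp (x , a , tTick₂)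
  tickNode₂ x nil       = nil
  tickNode₂ x (pfx _ _) = nil

  syncNode : Vertex g₁ → Node (Vertex g₁) → Vertex g₂ → Node V
  syncNode x (pfx (act α) x') y = jmp (x , y , tSync₂)
  syncNode x (ch a b)         y = ch (a , y , tSync) (b , y , tSync)
  syncNode x (jmp a)          y = jmp (a , y , tSync)
  syncNode x (pfx τ _)        y = nil
  syncNode x nil              y = nil
  syncNode x one              y = nil

  syncMatch : Act → Vertex g₁ → Act → Vertex g₂ → Node V
  syncMatch α x' β y' with β ≟ₐ bar α
  ... | yes _ = pfx τ (x' , y' , tMain)
  ... | no  _ = nil

  -- Having found the move α of x to x', look for a move bar α of y.
  syncPartner : Act → Vertex g₁ → Vertex g₁ → Node (Vertex g₂) → Node V
  syncPartner α x x' (pfx (act β) y') = syncMatch α x' β y'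
  syncPartner α x x' (ch a b)         = ch (x , a , tSync₂) (x , b , tSync₂)
  syncPartner α x x' (jmp a)          = jmp (x , a , tSync₂)
  syncPartner α x x' (pfx τ _)        = nil
  syncPartner α x x' nil              = nil
  syncPartner α x x' one              = nil

  syncNode₂ : Vertex g₁ → Node (Vertex g₁) → Vertex g₂ → Node V
  syncNode₂ x (pfx (act α) x') y = syncPartner α x x' (node g₂ y)
  syncNode₂ x (pfx τ _)        y = nil
  syncNode₂ x nil              y = nil
  syncNode₂ x one              y = nil
  syncNode₂ x (ch _ _)         y = nil
  syncNode₂ x (jmp _)          y = nil

  productNode : V → Node V
  productNode (x , y , tMain)  = ch (x , y , tLeft) (x , y , tMain₁)
  productNode (x , y , tMain₁) = ch (x , y , tRight) (x , y , tMain₂)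
  productNode (x , y , tMain₂) = ch (x , y , tSync) (x , y , tTick)
  productNode (x , y , tLeft)  = leftNode (node g₁ x) y
  productNode (x , y , tRight) = rightNode x (node g₂ y)
  productNode (x , y , tTick)  = tickNode x (node g₁ x) y
  productNode (x , y , tTick₂) = tickNode₂ x (node g₂ y)
  productNode (x , y , tSync)  = syncNode x (node g₁ x) y
  productNode (x , y , tSync₂) = syncNode₂ x (node g₁ x) y

  product : Graph
  product = record { Vertex = V ; node = productNode }

  IsPre : Lab → Set
  IsPre l = ∃ λ μ → l ≡ pre μ

  left-inv : ∀ {x y l t} → GStep product (x , y , tLeft) l t →
    IsPre l × ∃ λ x' → GStep g₁ x l x' × t ≡ (x' , y , tMain)
  left-inv {x} (at ns) with node g₁ x in e | ns
  ... | pfx μ x' | pfx→ = (μ , refl) , x' , along e pfx→ , refl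
  ... | ch a b   | chL g = let (isPre , x' , g' , t≡) = left-inv g in isPre , x' , along e (chL g') , t≡
  ... | ch a b   | chR g = let (isPre , x' , g' , t≡) = left-inv g in isPre , x' , along e (chR g') , t≡
  ... | jmp a    | jmp→ g = let (isPre , x' , g' , t≡) = left-inv g in isPre , x' , along e (jmp→ g') , t≡
  ... | nil      | ()
  ... | one      | ()

  left-lift : ∀ {x y μ x'} → GStep g₁ x (pre μ) x' → GStep product (x , y , tLeft) (pre μ) (x' , y , tMain)
  left-lift {x} {y} (at ns) with node g₁ x in e | ns
  ... | pfx μ x' | pfx→   = along (cong (λ n → leftNode n y) e) pfx→
  ... | ch a b   | chL g  = along (cong (λ n → leftNode n y) e) (chL (left-lift g))
  ... | ch a b   | chR g  = along (cong (λ n → leftNode n y) e) (chR (left-lift g))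
  ... | jmp a    | jmp→ g = along (cong (λ n → leftNode n y) e) (jmp→ (left-lift g))

  right-lift : ∀ {x y μ y'} → GStep g₂ y (pre μ) y' → GStep product (x , y , tRight) (pre μ) (x , y' , tMain)
  right-lift {x} {y} (at ns) with node g₂ y in e | ns
  ... | pfx μ y' | pfx→   = along (cong (rightNode x) e) pfx→
  ... | ch a b   | chL g  = along (cong (rightNode x) e) (chL (right-lift g))
  ... | ch a b   | chR g  = along (cong (rightNode x) e) (chR (right-lift g))
  ... | jmp a    | jmp→ g = along (cong (rightNode x) e) (jmp→ (right-lift g))

  right-inv : ∀ {x y l t} → GStep product (x , y , tRight) l t →
    IsPre l × ∃ λ y' → GStep g₂ y l y' × t ≡ (x , y' , tMain)
  right-inv {y = y} (at ns) with node g₂ y in e | ns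
  ... | pfx μ y' | pfx→   = (μ , refl) , y' , along e pfx→ , refl
  ... | ch a b   | chL g  = let (isPre , y' , g' , t≡) = right-inv g in isPre , y' , along e (chL g') , t≡
  ... | ch a b   | chR g  = let (isPre , y' , g' , t≡) = right-inv g in isPre , y' , along e (chR g') , t≡
  ... | jmp a    | jmp→ g = let (isPre , y' , g' , t≡) = right-inv g in isPre , y' , along e (jmp→ g') , t≡
  ... | nil      | ()
  ... | one      | ()

  tick₂-lift : ∀ {x y y' t} → GStep g₂ y ✓ y' → GStep product (x , y , tTick₂) ✓ t
  tick₂-lift {x} {y} (at ns) with node g₂ y in e | ns
  ... | one    | one✓   = along (cong (tickNode₂ x) e) one✓
  ... | ch a b | chL g  = along (cong (tickNode₂ x) e) (chL (tick₂-lift g))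
  ... | ch a b | chR g  = along (cong (tickNode₂ x) e) (chR (tick₂-lift g))
  ... | jmp a  | jmp→ g = along (cong (tickNode₂ x) e) (jmp→ (tick₂-lift g))

  tick-lift : ∀ {x y x' y' t} → GStep g₁ x ✓ x' → GStep g₂ y ✓ y' → GStep product (x , y , tTick) ✓ t
  tick-lift {x} {y} (at ns) h with node g₁ x in e | ns
  ... | one    | one✓   = along (cong (λ n → tickNode x n y) e) (jmp→ (tick₂-lift h))
  ... | ch a b | chL g  = along (cong (λ n → tickNode x n y) e) (chL (tick-lift g h))
  ... | ch a b | chR g  = along (cong (λ n → tickNode x n y) e) (chR (tick-lift g h))
  ... | jmp a  | jmp→ g = along (cong (λ n → tickNode x n y) e) (jmp→ (tick-lift g h))

  tick₂-inv : ∀ {x y l t} → GStep product (x , y , tTick₂) l t → l ≡ ✓ × Succeeds (graphLTS g₂) y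
  tick₂-inv {y = y} (at ns) with node g₂ y in e | ns
  ... | one    | one✓   = refl , y , along e one✓
  ... | ch a b | chL g  = let (l≡ , _ , g') = tick₂-inv g in l≡ , _ , along e (chL g')
  ... | ch a b | chR g  = let (l≡ , _ , g') = tick₂-inv g in l≡ , _ , along e (chR g')
  ... | jmp a  | jmp→ g = let (l≡ , _ , g') = tick₂-inv g in l≡ , _ , along e (jmp→ g')
  ... | nil    | ()
  ... | pfx _ _ | ()

  tick-inv : ∀ {x y l t} → GStep product (x , y , tTick) l t →
    l ≡ ✓ × Succeeds (graphLTS g₁) x × Succeeds (graphLTS g₂) y
  tick-inv {x} (at ns) with node g₁ x in e | ns
  ... | one    | jmp→ g = let (l≡ , ok₂) = tick₂-inv g in l≡ , (x , along e one✓) , ok₂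
  ... | ch a b | chL g  = let (l≡ , (_ , g') , ok₂) = tick-inv g in l≡ , (_ , along e (chL g')) , ok₂
  ... | ch a b | chR g  = let (l≡ , (_ , g') , ok₂) = tick-inv g in l≡ , (_ , along e (chR g')) , ok₂
  ... | jmp a  | jmp→ g = let (l≡ , (_ , g') , ok₂) = tick-inv g in l≡ , (_ , along e (jmp→ g')) , ok₂
  ... | nil    | ()
  ... | pfx _ _ | ()

  syncMatch-bar : ∀ α x' y' → syncMatch α x' (bar α) y' ≡ pfx τ (x' , y' , tMain)
  syncMatch-bar α x' y' with bar α ≟ₐ bar α
  ... | yes _  = refl
  ... | no  ≢  = ⊥-elim (≢ refl)

  syncMatch-inv : ∀ {α x' β y' l t} → NodeStep product (syncMatch α x' β y') l t →
    β ≡ bar α × l ≡ pre τ × t ≡ (x' , y' , tMain)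
  syncMatch-inv {α} {β = β} ns with β ≟ₐ bar α | ns
  ... | yes β≡ | pfx→ = β≡ , refl , refl
  ... | no  _  | ()

  sync₂-node : ∀ {x α x' y n} → node g₁ x ≡ pfx (act α) x' → node g₂ y ≡ n →
    node product (x , y , tSync₂) ≡ syncPartner α x x' n
  sync₂-node {x} {α} {x'} {y} e₁ e₂ = trans (cong (λ n → syncNode₂ x n y) e₁) (cong (syncPartner α x x') e₂)

  sync₂-lift : ∀ {x α x' y y'} → node g₁ x ≡ pfx (act α) x' → GStep g₂ y (pre (act (bar α))) y' →
    GStep product (x , y , tSync₂) (pre τ) (x' , y' , tMain)
  sync₂-lift {α = α} {x'} {y} e₁ (at ns) with node g₂ y in e₂ | ns
  ... | pfx _ y' | pfx→   = along (trans (sync₂-node e₁ e₂) (syncMatch-bar α x' y')) pfx→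
  ... | ch a b   | chL g  = along (sync₂-node e₁ e₂) (chL (sync₂-lift e₁ g))
  ... | ch a b   | chR g  = along (sync₂-node e₁ e₂) (chR (sync₂-lift e₁ g))
  ... | jmp a    | jmp→ g = along (sync₂-node e₁ e₂) (jmp→ (sync₂-lift e₁ g))

  sync-lift : ∀ {x α x' y y'} → GStep g₁ x (pre (act α)) x' → GStep g₂ y (pre (act (bar α))) y' →
    GStep product (x , y , tSync) (pre τ) (x' , y' , tMain)
  sync-lift {x} {y = y} (at ns) h with node g₁ x in e | ns
  ... | pfx _ _ | pfx→   = along (cong (λ n → syncNode x n y) e) (jmp→ (sync₂-lift e h))
  ... | ch a b  | chL g  = along (cong (λ n → syncNode x n y) e) (chL (sync-lift g h))
  ... | ch a b  | chR g  = along (cong (λ n → syncNode x n y) e) (chR (sync-lift g h))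
  ... | jmp a   | jmp→ g = along (cong (λ n → syncNode x n y) e) (jmp→ (sync-lift g h))

  sync₂-inv : ∀ {x α x' y l t} → node g₁ x ≡ pfx (act α) x' → GStep product (x , y , tSync₂) l t →
    l ≡ pre τ × ∃ λ y' → GStep g₂ y (pre (act (bar α))) y' × t ≡ (x' , y' , tMain)
  sync₂-inv {x} {y = y} e₁ (at ns) with node g₁ x | e₁ | ns
  ... | _ | refl | ns' with node g₂ y in e₂ | ns'
  ...   | pfx (act β) y' | ns'' with syncMatch-inv ns''
  ...     | refl , refl , refl = refl , y' , along e₂ pfx→ , refl
  sync₂-inv {x} {y = y} e₁ (at ns) | _ | refl | ns' | ch a b | chL g =
    let (l≡ , y' , g' , t≡) = sync₂-inv e₁ g in l≡ , y' , along e₂ (chL g') , t≡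
  sync₂-inv {x} {y = y} e₁ (at ns) | _ | refl | ns' | ch a b | chR g =
    let (l≡ , y' , g' , t≡) = sync₂-inv e₁ g in l≡ , y' , along e₂ (chR g') , t≡
  sync₂-inv {x} {y = y} e₁ (at ns) | _ | refl | ns' | jmp a | jmp→ g =
    let (l≡ , y' , g' , t≡) = sync₂-inv e₁ g in l≡ , y' , along e₂ (jmp→ g') , t≡
  sync₂-inv {x} {y = y} e₁ (at ns) | _ | refl | ns' | pfx τ _ | ()
  sync₂-inv {x} {y = y} e₁ (at ns) | _ | refl | ns' | nil | ()
  sync₂-inv {x} {y = y} e₁ (at ns) | _ | refl | ns' | one | ()

  sync-inv : ∀ {x y l t} → GStep product (x , y , tSync) l t →
    l ≡ pre τ × ∃ λ α → ∃ λ x' → ∃ λ y' →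
      GStep g₁ x (pre (act α)) x' × GStep g₂ y (pre (act (bar α))) y' × t ≡ (x' , y' , tMain)
  sync-inv {x} (at ns) with node g₁ x in e | ns
  ... | pfx (act α) x' | jmp→ g =
    let (l≡ , y' , h , t≡) = sync₂-inv e g in l≡ , α , x' , y' , along e pfx→ , h , t≡
  ... | ch a b | chL g =
    let (l≡ , α , x' , y' , g' , h , t≡) = sync-inv g in l≡ , α , x' , y' , along e (chL g') , h , t≡
  ... | ch a b | chR g =
    let (l≡ , α , x' , y' , g' , h , t≡) = sync-inv g in l≡ , α , x' , y' , along e (chR g') , h , t≡
  ... | jmp a  | jmp→ g =
    let (l≡ , α , x' , y' , g' , h , t≡) = sync-inv g in l≡ , α , x' , y' , along e (jmp→ g') , h , t≡
  ... | pfx τ _ | ()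
  ... | nil     | ()
  ... | one     | ()

  data Paired (R₁ : Conf → Vertex g₁ → Set) (R₂ : Conf → Vertex g₂ → Set) : Conf → V → Set where
    paired : ∀ {c d x y} → R₁ c x → R₂ d y → Paired R₁ R₂ (c ∥ d) (x , y , tMain)

  product-≈ : ∀ {c d x y} → Bisimilar ConfLTS (graphLTS g₁) c x → Bisimilar ConfLTS (graphLTS g₂) d y →
    Bisimilar ConfLTS (graphLTS product) (c ∥ d) (x , y , tMain)
  product-≈ (R₁ , B₁ , r₁) (R₂ , B₂ , r₂) =
    Paired R₁ R₂ , record { forth = fwd ; back = bwd ; ✓-forth = ok-fwd ; ✓-back = ok-bwd } , paired r₁ r₂
    where
    fwd : ∀ {u v μ u'} → Paired R₁ R₂ u v → u ═[ pre μ ]⇒ u' → ∃ λ v' → GStep product v (pre μ) v' × Paired R₁ R₂ u' v'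
    fwd (paired r s) (parL t) = let (_ , g , r') = forth B₁ r t in
      _ , at (chL (left-lift g)) , paired r' s
    fwd (paired r s) (parR t) = let (_ , g , s') = forth B₂ s t in
      _ , at (chR (at (chL (right-lift g)))) , paired r s'
    fwd (paired r s) (sync t₁ t₂) = let (_ , h₁ , r') = forth B₁ r t₁ ; (_ , h₂ , s') = forth B₂ s t₂ in
      _ , at (chR (at (chR (at (chL (sync-lift h₁ h₂)))))) , paired r' s'
    bwd : ∀ {u v μ v'} → Paired R₁ R₂ u v → GStep product v (pre μ) v' → ∃ λ u' → u ═[ pre μ ]⇒ u' × Paired R₁ R₂ u' v'
    bwd (paired r s) (at (chL g)) with left-inv g
    ... | _ , _ , g' , refl = let (_ , t , r') = back B₁ r g' in _ , parL t , paired r' s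
    bwd (paired r s) (at (chR (at (chL g)))) with right-inv g
    ... | _ , _ , g' , refl = let (_ , t , s') = back B₂ s g' in _ , parR t , paired r s'
    bwd (paired r s) (at (chR (at (chR (at (chL g)))))) with sync-inv g
    ... | refl , _ , _ , _ , h₁ , h₂ , refl =
      let (_ , t₁ , r') = back B₁ r h₁ ; (_ , t₂ , s') = back B₂ s h₂ in _ , sync t₁ t₂ , paired r' s'
    bwd (paired r s) (at (chR (at (chR (at (chR g)))))) with tick-inv g
    ... | () , _
    ok-fwd : ∀ {u v} → Paired R₁ R₂ u v → Succeeds ConfLTS u → Succeeds (graphLTS product) v
    ok-fwd (paired {x = x} {y} r s) (_ , both✓ t₁ t₂) =
      let (_ , h₁) = ✓-forth B₁ r (_ , t₁) ; (_ , h₂) = ✓-forth B₂ s (_ , t₂) in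
      (x , y , tMain) , at (chR (at (chR (at (chR (tick-lift h₁ h₂))))))
    ok-bwd : ∀ {u v} → Paired R₁ R₂ u v → Succeeds (graphLTS product) v → Succeeds ConfLTS u
    ok-bwd (paired r s) (_ , at (chL g)) with left-inv g
    ... | (_ , ()) , _
    ok-bwd (paired r s) (_ , at (chR (at (chL g)))) with right-inv g
    ... | (_ , ()) , _
    ok-bwd (paired r s) (_ , at (chR (at (chR (at (chL g)))))) with sync-inv g
    ... | () , _
    ok-bwd (paired r s) (_ , at (chR (at (chR (at (chR g)))))) with tick-inv g
    ... | _ , ok₁ , ok₂ = let (_ , t₁) = ✓-back B₁ r ok₁ ; (_ , t₂) = ✓-back B₂ s ok₂ in _ , both✓ t₁ t₂

  product-names : ∀ {P} → GraphNames P g₁ → GraphNames P g₂ → GraphNames P product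
  product-names n₁ n₂ (x , y , tMain)  = tt
  product-names n₁ n₂ (x , y , tMain₁) = tt
  product-names n₁ n₂ (x , y , tMain₂) = tt
  product-names n₁ n₂ (x , y , tLeft)  = left-names (node g₁ x) (n₁ x)
    where
    left-names : ∀ {P} n → NodeNames P n → NodeNames P (leftNode n y)
    left-names (pfx _ _) ok = ok
    left-names (ch _ _)  _  = tt
    left-names (jmp _)   _  = tt
    left-names nil       _  = tt
    left-names one       _  = tt
  product-names n₁ n₂ (x , y , tRight) = right-names (node g₂ y) (n₂ y)
    where
    right-names : ∀ {P} n → NodeNames P n → NodeNames P (rightNode x n)
    right-names (pfx _ _) ok = ok
    right-names (ch _ _)  _  = tt
    right-names (jmp _)   _  = tt
    right-names nil       _  = tt
    right-names one       _  = tt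
  product-names n₁ n₂ (x , y , tTick) with node g₁ x
  ... | one     = tt
  ... | ch _ _  = tt
  ... | jmp _   = tt
  ... | nil     = tt
  ... | pfx _ _ = tt
  product-names n₁ n₂ (x , y , tTick₂) with node g₂ y
  ... | one     = tt
  ... | ch _ _  = tt
  ... | jmp _   = tt
  ... | nil     = tt
  ... | pfx _ _ = tt
  product-names n₁ n₂ (x , y , tSync) with node g₁ x
  ... | pfx (act _) _ = tt
  ... | pfx τ _       = tt
  ... | ch _ _        = tt
  ... | jmp _         = tt
  ... | nil           = tt
  ... | one           = tt
  product-names n₁ n₂ (x , y , tSync₂) with node g₁ x
  ... | pfx (act α) x' = partner-names (node g₂ y)
    where
    partner-names : ∀ {P} n → NodeNames P (syncPartner α x x' n)
    partner-names (pfx (act β) y') with β ≟ₐ bar α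
    ... | yes _ = λ ()
    ... | no  _ = tt
    partner-names (pfx τ _) = tt
    partner-names (ch _ _)  = tt
    partner-names (jmp _)   = tt
    partner-names nil       = tt
    partner-names one       = tt
  ... | pfx τ _ = tt
  ... | ch _ _  = tt
  ... | jmp _   = tt
  ... | nil     = tt
  ... | one     = tt

record Finite (A : Set) : Set where
  field
    _≟_      : (a b : A) → Dec (a ≡ b)
    enum     : List A
    complete : ∀ a → a ∈ enum

data Distinct {A : Set} : List A → Set where
  []  : Distinct []
  _∷_ : ∀ {x xs} → ¬ x ∈ xs → Distinct xs → Distinct (x ∷ xs)

Distinct-lookup-injective : ∀ {A : Set} {xs : List A} → Distinct xs → ∀ i j → lookup xs i ≡ lookup xs j → i ≡ j
Distinct-lookup-injective (x∉ ∷ d) zero    zero    e = refl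
Distinct-lookup-injective {xs = x ∷ xs} (x∉ ∷ d) zero (suc j) e = ⊥-elim (x∉ (≡-subst (_∈ xs) (sym e) (∈-lookup j)))
Distinct-lookup-injective {xs = x ∷ xs} (x∉ ∷ d) (suc i) zero e = ⊥-elim (x∉ (≡-subst (_∈ xs) e (∈-lookup i)))
Distinct-lookup-injective (x∉ ∷ d) (suc i) (suc j) e = cong suc (Distinct-lookup-injective d i j e)

Distinct-length : ∀ {A : Set} (fin : Finite A) {xs : List A} → Distinct xs → length xs ≤ length (Finite.enum fin)
Distinct-length fin {xs} d = injective⇒≤ {f = position} position-injective
  where
  open Finite fin
  position : Fin (length xs) → Fin (length enum)
  position i = index (complete (lookup xs i))
  position-injective : ∀ {i j} → position i ≡ position j → i ≡ j
  position-injective {i} {j} e = Distinct-lookup-injective d i j (trans (lookup-index (complete (lookup xs i)))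
    (trans (cong (lookup enum) e) (sym (lookup-index (complete (lookup xs j))))))

Finite-Fin : ∀ n → Finite (Fin n)
Finite-Fin n = record { _≟_ = _≟ᶠ_ ; enum = allFin n ; complete = ∈-allFin }

Finite-× : ∀ {A B} → Finite A → Finite B → Finite (A × B)
Finite-× finA finB = record
  { _≟_      = ≡-dec (Finite._≟_ finA) (Finite._≟_ finB)
  ; enum     = cartesianProduct (Finite.enum finA) (Finite.enum finB)
  ; complete = λ { (a , b) → ∈-cartesianProduct⁺ (Finite.complete finA a) (Finite.complete finB b) } }

_≟ₚ_ : ∀ {t} (i j : Pos t) → Dec (i ≡ j)
root     ≟ₚ root     = yes refl
pre↓ i   ≟ₚ pre↓ j   = map′ (cong pre↓) (λ { refl → refl }) (i ≟ₚ j)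
left↓ i  ≟ₚ left↓ j  = map′ (cong left↓) (λ { refl → refl }) (i ≟ₚ j)
right↓ i ≟ₚ right↓ j = map′ (cong right↓) (λ { refl → refl }) (i ≟ₚ j)
body↓ i  ≟ₚ body↓ j  = map′ (cong body↓) (λ { refl → refl }) (i ≟ₚ j)
root     ≟ₚ pre↓ _   = no λ ()
root     ≟ₚ left↓ _  = no λ ()
root     ≟ₚ right↓ _ = no λ ()
root     ≟ₚ body↓ _  = no λ ()
pre↓ _   ≟ₚ root     = no λ ()
left↓ _  ≟ₚ root     = no λ ()
right↓ _ ≟ₚ root     = no λ ()
body↓ _  ≟ₚ root     = no λ ()
left↓ _  ≟ₚ right↓ _ = no λ ()
right↓ _ ≟ₚ left↓ _  = no λ ()

allPos : ∀ t → List (Pos t)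
allPos (μ ∙ q) = root ∷ map pre↓ (allPos q)
allPos (q ⊕ r) = root ∷ (map left↓ (allPos q) ++ map right↓ (allPos r))
allPos (rec q) = root ∷ map body↓ (allPos q)
allPos 𝟘       = root ∷ []
allPos 𝟙       = root ∷ []
allPos (var k) = root ∷ []

∈-allPos : ∀ t (i : Pos t) → i ∈ allPos t
∈-allPos 𝟘       root       = here refl
∈-allPos 𝟙       root       = here refl
∈-allPos (var k) root       = here refl
∈-allPos (μ ∙ q) root       = here refl
∈-allPos (q ⊕ r) root       = here refl
∈-allPos (rec q) root       = here refl
∈-allPos (μ ∙ q) (pre↓ i)   = there (∈-map⁺ pre↓ (∈-allPos q i))
∈-allPos (q ⊕ r) (left↓ i)  = there (∈-++⁺ˡ (∈-map⁺ left↓ (∈-allPos q i)))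
∈-allPos (q ⊕ r) (right↓ i) = there (∈-++⁺ʳ (map left↓ (allPos q)) (∈-map⁺ right↓ (∈-allPos r i)))
∈-allPos (rec q) (body↓ i)  = there (∈-map⁺ body↓ (∈-allPos q i))

Finite-Pos : ∀ t → Finite (Pos t)
Finite-Pos t = record { _≟_ = _≟ₚ_ ; enum = allPos t ; complete = ∈-allPos t }

-- Finite graphs as processes

-- A finite graph unfolds into a process: a vertex becomes a rec binder, and a
-- vertex met again below its own binder becomes the variable pointing back to it.
module Encoding (g : Graph) (fin : Finite (Vertex g)) where
  open Finite fin

  N : ℕ
  N = length enum

  indexOf : Vertex g → List (Vertex g) → Maybe ℕ
  indexOf s []       = nothing
  indexOf s (x ∷ xs) with s ≟ x
  ... | yes _ = just 0
  ... | no  _ = Maybe.map suc (indexOf s xs)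

  indexOf-nothing : ∀ s xs → indexOf s xs ≡ nothing → ¬ s ∈ xs
  indexOf-nothing s (x ∷ xs) e s∈ with s ≟ x
  indexOf-nothing s (x ∷ xs) () s∈ | yes _
  indexOf-nothing s (x ∷ xs) e (here refl) | no s≢x = s≢x refl
  indexOf-nothing s (x ∷ xs) e (there s∈) | no _ with indexOf s xs in e'
  indexOf-nothing s (x ∷ xs) () (there s∈) | no _ | just _
  ... | nothing = indexOf-nothing s xs e' s∈

  indexOf-< : ∀ s xs {d} → indexOf s xs ≡ just d → d < length xs
  indexOf-< s (x ∷ xs) e with s ≟ x
  indexOf-< s (x ∷ xs) refl | yes _ = s≤s z≤n
  ... | no _ with indexOf s xs in e'
  indexOf-< s (x ∷ xs) refl | no _ | just d = s≤s (indexOf-< s xs e')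

  -- The stack lists the vertices whose binders enclose the term, innermost
  -- first; the fuel only serves termination and never runs out (Env-fuel-pos).
  mutual
    encode : ℕ → Vertex g → List (Vertex g) → Proc
    encode fuel s stack = encodeAt fuel s stack (indexOf s stack)

    encodeAt : ℕ → Vertex g → List (Vertex g) → Maybe ℕ → Proc
    encodeAt fuel       s stack (just d) = var d
    encodeAt zero       s stack nothing  = 𝟘
    encodeAt (suc fuel) s stack nothing  = rec (encodeNode fuel (node g s) (s ∷ stack))

    encodeNode : ℕ → Node (Vertex g) → List (Vertex g) → Proc
    encodeNode fuel nil       stack = 𝟘
    encodeNode fuel one       stack = 𝟙
    encodeNode fuel (pfx μ t) stack = μ ∙ encode fuel t stack
    encodeNode fuel (ch a b)  stack = encode fuel a stack ⊕ encode fuel b stack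
    encodeNode fuel (jmp a)   stack = encode fuel a stack

  mutual
    Closed-encode : ∀ fuel s stack → Closed (length stack) (encode fuel s stack)
    Closed-encode fuel s stack = Closed-encodeAt fuel s stack (indexOf s stack) refl

    Closed-encodeAt : ∀ fuel s stack m → indexOf s stack ≡ m → Closed (length stack) (encodeAt fuel s stack m)
    Closed-encodeAt fuel       s stack (just d) e = indexOf-< s stack e
    Closed-encodeAt zero       s stack nothing  e = tt
    Closed-encodeAt (suc fuel) s stack nothing  e = Closed-encodeNode fuel (node g s) (s ∷ stack)

    Closed-encodeNode : ∀ fuel n stack → Closed (length stack) (encodeNode fuel n stack)
    Closed-encodeNode fuel nil       stack = tt
    Closed-encodeNode fuel one       stack = tt
    Closed-encodeNode fuel (pfx μ t) stack = Closed-encode fuel t stack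
    Closed-encodeNode fuel (ch a b)  stack = Closed-encode fuel a stack , Closed-encode fuel b stack
    Closed-encodeNode fuel (jmp a)   stack = Closed-encode fuel a stack

  -- Env φ stack fuel: φ holds the closed processes bound by the binders of the
  -- stack, as produced by encoding from the root with fuel suc N.
  data Env : List Proc → List (Vertex g) → ℕ → Set where
    []ₑ  : Env [] [] (suc N)
    push : ∀ {φ stack fuel s} → Env φ stack (suc fuel) → indexOf s stack ≡ nothing →
           Env (substs φ 0 (encode (suc fuel) s stack) ∷ φ) (s ∷ stack) fuel

  Env-length : ∀ {φ stack fuel} → Env φ stack fuel → length φ ≡ length stack
  Env-length []ₑ        = refl
  Env-length (push E _) = cong suc (Env-length E)

  Closed-encode-in : ∀ {φ stack fuel} → Env φ stack fuel → ∀ fuel' s → Closed (length φ) (encode fuel' s stack)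
  Closed-encode-in {stack = stack} E fuel' s =
    ≡-subst (λ k → Closed k (encode fuel' s stack)) (sym (Env-length E)) (Closed-encode fuel' s stack)

  Env-closed : ∀ {φ stack fuel} → Env φ stack fuel → All (Closed 0) φ
  Env-closed []ₑ = []
  Env-closed (push {φ} {fuel = fuel} {s} E _) =
    Closed-substs φ (Env-closed E) (encode (suc fuel) s _) (Closed-encode-in E (suc fuel) s) ∷ Env-closed E

  Env-distinct : ∀ {φ stack fuel} → Env φ stack fuel → Distinct stack
  Env-distinct []ₑ = []
  Env-distinct {stack = s ∷ stack} (push E s∉) = indexOf-nothing s stack s∉ ∷ Env-distinct E

  Env-fuel : ∀ {φ stack fuel} → Env φ stack fuel → fuel + length stack ≡ suc N
  Env-fuel []ₑ = +-identityʳ _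
  Env-fuel {stack = s ∷ stack} {fuel} (push E _) = trans (+-suc fuel (length stack)) (Env-fuel E)

  -- The stack is a list of distinct vertices, so it never exceeds N.
  Env-fuel-pos : ∀ {φ stack fuel} → Env φ stack fuel → ∃ λ fuel' → fuel ≡ suc fuel'
  Env-fuel-pos {fuel = suc fuel'} E = fuel' , refl
  Env-fuel-pos {fuel = zero} E =
    ⊥-elim (1+n≰n (≤-trans (≤-reflexive (sym (Env-fuel E))) (Distinct-length fin (Env-distinct E))))

  Env-lookup : ∀ {φ stack fuel s d} → Env φ stack fuel → indexOf s stack ≡ just d →
    ∃ λ φ' → ∃ λ stack' → ∃ λ fuel' → Env φ' stack' (suc fuel') × indexOf s stack' ≡ nothing ×
      lookup? φ d ≡ just (substs φ' 0 (encode (suc fuel') s stack'))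
  Env-lookup {stack = x ∷ stack} {s = s} (push E s∉) e with s ≟ x
  Env-lookup {stack = x ∷ stack} {s = .x} (push E s∉) refl | yes refl = _ , _ , _ , E , s∉ , refl
  ... | no _ with indexOf s stack in e'
  Env-lookup {stack = x ∷ stack} {s = s} (push E s∉) refl | no _ | just d = Env-lookup E e'

  encode-rec : ∀ fuel s stack → indexOf s stack ≡ nothing →
    encode (suc fuel) s stack ≡ rec (encodeNode fuel (node g s) (s ∷ stack))
  encode-rec fuel s stack e with indexOf s stack
  encode-rec fuel s stack refl | nothing = refl

  substs-encode-rec : ∀ {φ stack fuel s} → Env φ stack (suc fuel) → indexOf s stack ≡ nothing →
    substs φ 0 (encode (suc fuel) s stack) ≡ rec (substs φ 1 (encodeNode fuel (node g s) (s ∷ stack)))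
  substs-encode-rec {φ} {stack} {fuel} {s} E s∉ =
    trans (cong (substs φ 0) (encode-rec fuel s stack s∉)) (substs-rec φ (Env-closed E) 0 _)

  encode-unfold : ∀ {φ stack fuel s} → Env φ stack (suc fuel) → indexOf s stack ≡ nothing →
    let B = encodeNode fuel (node g s) (s ∷ stack) in
    subst 0 (rec (substs φ 1 B)) (substs φ 1 B) ≡ substs (substs φ 0 (encode (suc fuel) s stack) ∷ φ) 0 B
  encode-unfold {φ} {stack} {fuel} {s} E s∉ =
    trans (substs-unfold φ (Env-closed E) B closed-rec)
          (cong (λ X → substs (substs φ 0 X ∷ φ) 0 B) (sym (encode-rec fuel s stack s∉)))
    where
    B = encodeNode fuel (node g s) (s ∷ stack)
    closed-rec : Closed (length φ) (rec B)
    closed-rec = ≡-subst (Closed (length φ)) (encode-rec fuel s stack s∉) (Closed-encode-in E (suc fuel) s)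

  encode-binder : ∀ {φ stack fuel} s → Env φ stack fuel →
    ∃ λ φ' → ∃ λ stack' → ∃ λ fuel' → Env φ' stack' (suc fuel') × indexOf s stack' ≡ nothing ×
      substs φ 0 (encode fuel s stack) ≡ rec (substs φ' 1 (encodeNode fuel' (node g s) (s ∷ stack')))
  encode-binder {φ} {stack} s E with indexOf s stack in e
  ... | just d =
    let (φ' , stack' , fuel' , E' , s∉ , φd≡) = Env-lookup E e in
    φ' , stack' , fuel' , E' , s∉ , trans (substs-var-just φ (Env-closed E) d φd≡) (substs-encode-rec E' s∉)
  ... | nothing with Env-fuel-pos E
  ...   | fuel' , refl = φ , stack , fuel' , E , e , substs-rec φ (Env-closed E) 0 _

  Encodes : Proc → Vertex g → Set
  Encodes u s = ∃ λ φ → ∃ λ stack → ∃ λ fuel → Env φ stack fuel × u ≡ substs φ 0 (encode fuel s stack)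

  Matches : Lab → Proc → Vertex g → Set
  Matches (pre μ) u s' = Encodes u s'
  Matches ✓       u s' = ⊤

  Forth : Vertex g → Lab → Proc → Set
  Forth s l u = ∃ λ s' → GStep g s l s' × Matches l u s'

  Back : Proc → Lab → Vertex g → Set
  Back x l s' = ∃ λ u → x ─[ l ]→ u × Matches l u s'

  mutual
    step⇒graph : ∀ {x l u φ stack fuel} s → x ─[ l ]→ u → Env φ stack fuel →
      x ≡ substs φ 0 (encode fuel s stack) → Forth s l u
    step⇒graph s t E x≡ = let (_ , _ , _ , E' , s∉ , ≡rec) = encode-binder s E in unfold⇒graph t E' s∉ (trans x≡ ≡rec)

    unfold⇒graph : ∀ {x l u φ stack fuel s} → x ─[ l ]→ u → Env φ stack (suc fuel) → indexOf s stack ≡ nothing →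
      x ≡ rec (substs φ 1 (encodeNode fuel (node g s) (s ∷ stack))) → Forth s l u
    unfold⇒graph {s = s} (unf t) E s∉ refl = node⇒graph t (node g s) refl (push E s∉) (encode-unfold E s∉)

    node⇒graph : ∀ {x l u φ stack fuel s} → x ─[ l ]→ u → ∀ n → node g s ≡ n → Env φ stack fuel →
      x ≡ substs φ 0 (encodeNode fuel n stack) → Forth s l u
    node⇒graph {φ = φ} t nil n≡ E x≡ = ⊥-elim (𝟘-stuck (step-≡ (trans x≡ (substs-𝟘 φ 0)) t))
    node⇒graph {φ = φ} {s = s} t one n≡ E x≡ = go t (trans x≡ (substs-𝟙 φ 0))
      where
      go : ∀ {x l u} → x ─[ l ]→ u → x ≡ 𝟙 → Forth s l u
      go succ refl = s , along n≡ one✓ , tt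
    node⇒graph {φ = φ} {stack} {fuel} t (pfx μ s') n≡ E x≡ = go t (trans x≡ (substs-∙ φ 0 μ _))
      where
      go : ∀ {x l u} → x ─[ l ]→ u → x ≡ μ ∙ substs φ 0 (encode fuel s' stack) → Forth _ l u
      go pref refl = s' , along n≡ pfx→ , (φ , stack , fuel , E , refl)
    node⇒graph {φ = φ} {stack} {fuel} t (ch a b) n≡ E x≡ = go t (trans x≡ (substs-⊕ φ 0 _ _))
      where
      go : ∀ {x l u} → x ─[ l ]→ u → x ≡ substs φ 0 (encode fuel a stack) ⊕ substs φ 0 (encode fuel b stack) → Forth _ l u
      go (sumL t') refl = let (s' , h , m) = step⇒graph a t' E refl in s' , along n≡ (chL h) , m
      go (sumR t') refl = let (s' , h , m) = step⇒graph b t' E refl in s' , along n≡ (chR h) , m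
    node⇒graph t (jmp a) n≡ E x≡ = let (s' , h , m) = step⇒graph a t E x≡ in s' , along n≡ (jmp→ h) , m

  mutual
    graph⇒step : ∀ {s l s' φ stack fuel} → GStep g s l s' → Env φ stack fuel →
      Back (substs φ 0 (encode fuel s stack)) l s'
    graph⇒step {s} (at ns) E =
      let (_ , _ , _ , E' , s∉ , ≡rec) = encode-binder s E
          (u , t , m) = node⇒step ns (push E' s∉)
      in u , step-≡ (sym ≡rec) (unf (step-≡ (sym (encode-unfold E' s∉)) t)) , m

    node⇒step : ∀ {n l s' φ stack fuel} → NodeStep g n l s' → Env φ stack fuel →
      Back (substs φ 0 (encodeNode fuel n stack)) l s'
    node⇒step {φ = φ} one✓ E = 𝟘 , step-≡ (sym (substs-𝟙 φ 0)) succ , tt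
    node⇒step {φ = φ} {stack} {fuel} (pfx→ {μ}) E =
      _ , step-≡ (sym (substs-∙ φ 0 μ _)) pref , (φ , stack , fuel , E , refl)
    node⇒step {φ = φ} (chL h) E = let (u , t , m) = graph⇒step h E in u , step-≡ (sym (substs-⊕ φ 0 _ _)) (sumL t) , m
    node⇒step {φ = φ} (chR h) E = let (u , t , m) = graph⇒step h E in u , step-≡ (sym (substs-⊕ φ 0 _ _)) (sumR t) , m
    node⇒step (jmp→ h) E = graph⇒step h E

  encode-≈ : ∀ s → Bisimilar ConfLTS (graphLTS g) ⟨ encode (suc N) s [] ⟩ s
  encode-≈ s = (λ x s → ∃ λ u → x ≡ ⟨ u ⟩ × Encodes u s) , record
    { forth   = λ { (u , refl , (φ , stack , fuel , E , u≡)) (lift t) →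
                    let (s' , h , m) = step⇒graph _ t E u≡ in s' , h , (_ , refl , m) }
    ; back    = λ { (u , refl , (φ , stack , fuel , E , refl)) h →
                    let (u' , t , m) = graph⇒step h E in ⟨ u' ⟩ , lift t , (_ , refl , m) }
    ; ✓-forth = λ { (u , refl , (φ , stack , fuel , E , u≡)) (_ , lift t) →
                    let (s' , h , _) = step⇒graph _ t E u≡ in s' , h }
    ; ✓-back  = λ { (u , refl , (φ , stack , fuel , E , refl)) (_ , h) →
                    let (u' , t , _) = graph⇒step h E in ⟨ u' ⟩ , lift t } }
    , (_ , refl , ([] , [] , suc N , []ₑ , refl))

  mutual
    encode-names : ∀ {P} → GraphNames P g → ∀ fuel s stack {a} → a ∈n encode fuel s stack → P a
    encode-names names fuel s stack = encodeAt-names names fuel s stack (indexOf s stack)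

    encodeAt-names : ∀ {P} → GraphNames P g → ∀ fuel s stack m {a} → a ∈n encodeAt fuel s stack m → P a
    encodeAt-names names fuel       s stack (just d) ()
    encodeAt-names names zero       s stack nothing  ()
    encodeAt-names names (suc fuel) s stack nothing  (inRec a∈) = encodeNode-names names fuel (node g s) (names s) (s ∷ stack) a∈

    encodeNode-names : ∀ {P} → GraphNames P g → ∀ fuel n → NodeNames P n → ∀ stack {a} → a ∈n encodeNode fuel n stack → P a
    encodeNode-names names fuel nil                   ok stack ()
    encodeNode-names names fuel one                   ok stack ()
    encodeNode-names names fuel (pfx (act (nm b)) t)  ok stack here-nm    = ok refl
    encodeNode-names names fuel (pfx (act (co b)) t)  ok stack here-co    = ok refl
    encodeNode-names names fuel (pfx μ t)             ok stack (there a∈) = encode-names names fuel t stack a∈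
    encodeNode-names names fuel (ch a b)              ok stack (inL a∈)   = encode-names names fuel a stack a∈
    encodeNode-names names fuel (ch a b)              ok stack (inR a∈)   = encode-names names fuel b stack a∈
    encodeNode-names names fuel (jmp a)               ok stack a∈         = encode-names names fuel a stack a∈

-- Configurations as processes

data _∈nᶜ_ (a : Name) : Conf → Set where
  proc∈  : ∀ {p}   → a ∈n p  → a ∈nᶜ ⟨ p ⟩
  left∈  : ∀ {c d} → a ∈nᶜ c → a ∈nᶜ (c ∥ d)
  right∈ : ∀ {c d} → a ∈nᶜ d → a ∈nᶜ (c ∥ d)

confGraph : Conf → Graph
confGraph ⟨ p ⟩   = PositionGraph.graph (close p) (Closed-close p)
confGraph (c ∥ d) = Product.product (confGraph c) (confGraph d)

confRoot : ∀ c → Vertex (confGraph c)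
confRoot ⟨ p ⟩   = root
confRoot (c ∥ d) = confRoot c , confRoot d , tMain

Finite-confGraph : ∀ c → Finite (Vertex (confGraph c))
Finite-confGraph ⟨ p ⟩   = Finite-Pos (close p)
Finite-confGraph (c ∥ d) = Finite-× (Finite-confGraph c) (Finite-× (Finite-confGraph d) (Finite-Fin 9))

confGraph-≈ : ∀ c → Bisimilar ConfLTS (graphLTS (confGraph c)) c (confRoot c)
confGraph-≈ ⟨ p ⟩   = bisim-trans (close-≈ p) (PositionGraph.positionGraph-≈ (close p) (Closed-close p))
confGraph-≈ (c ∥ d) = Product.product-≈ (confGraph c) (confGraph d) (confGraph-≈ c) (confGraph-≈ d)

confGraph-names : ∀ c → GraphNames (_∈nᶜ c) (confGraph c)
confGraph-names ⟨ p ⟩ =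
  GraphNames-map (λ a∈ → proc∈ (∈n-close p a∈)) (PositionGraph.positionGraph-names (close p) (Closed-close p))
confGraph-names (c ∥ d) = Product.product-names (confGraph c) (confGraph d)
  (GraphNames-map left∈ (confGraph-names c)) (GraphNames-map right∈ (confGraph-names d))

toProc : Conf → Proc
toProc c = let open Encoding (confGraph c) (Finite-confGraph c) in encode (suc N) (confRoot c) []

toProc-≈ : ∀ c → ⟨ toProc c ⟩ ≈ c
toProc-≈ c = bisim-trans (Encoding.encode-≈ (confGraph c) (Finite-confGraph c) (confRoot c)) (bisim-sym (confGraph-≈ c))

toProc-names : ∀ c {a} → a ∈n toProc c → a ∈nᶜ c
toProc-names c = Encoding.encode-names (confGraph c) (Finite-confGraph c) (confGraph-names c) _ (confRoot c) []

-- Regrouping tests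

∈nᶜ-⨂ : ∀ {k} (g : Fin (suc k) → Conf) {a} → a ∈nᶜ ⨂ g → ∃ λ j → a ∈nᶜ g j
∈nᶜ-⨂ {zero}  g a∈          = zero , a∈
∈nᶜ-⨂ {suc k} g (left∈ a∈)  = zero , a∈
∈nᶜ-⨂ {suc k} g (right∈ a∈) = let (j , a∈') = ∈nᶜ-⨂ (λ i → g (suc i)) a∈ in suc j , a∈'

module Regroup {m n} (f : Fin (suc m) → Fin (suc n)) (o : Fin (suc m) → Conf) where

  member : Fin (suc n) → Fin (suc m) → Conf
  member i j with f j ≟ᶠ i
  ... | yes _ = o j
  ... | no  _ = ⟨ 𝟙 ⟩

  block : Fin (suc n) → Conf
  block i = ⨂ (member i)

  member-own : ∀ j → member (f j) j ≡ o j
  member-own j with f j ≟ᶠ f j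
  ... | yes _   = refl
  ... | no  f≢f = ⊥-elim (f≢f refl)

  member-other : ∀ j i → ¬ i ≡ f j → member i j ≡ ⟨ 𝟙 ⟩
  member-other j i i≢fj with f j ≟ᶠ i
  ... | yes fj≡i = ⊥-elim (i≢fj (sym fj≡i))
  ... | no  _    = refl

  ⨂-regroup : ⨂ o ≈ ⨂ block
  ⨂-regroup = begin
    ⨂ o                                 ≈⟨ ⨂-cong (λ j → ≈-sym (single j)) ⟩
    ⨂ (λ j → ⨂ (λ i → member i j))      ≈⟨ ≈-sym (⨂-interchange member) ⟩
    ⨂ block                             ∎
    where
    open SetoidReasoning ≈-setoid
    single : ∀ j → ⨂ (λ i → member i j) ≈ o j
    single j = ≈-trans (⨂-single (λ i → member i j) (f j) (member-other j)) (≡⇒≈ (member-own j))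

  block-names : ∀ i {a} → a ∈nᶜ block i → ∃ λ j → f j ≡ i × a ∈nᶜ o j
  block-names i a∈ with ∈nᶜ-⨂ (member i) a∈
  ... | j , a∈ⱼ with f j ≟ᶠ i
  ...   | yes fj≡i = j , fj≡i , a∈ⱼ
  ...   | no  _    with a∈ⱼ
  ...     | proc∈ ()

lemma5p1 : ∀ (I I' : Interface) → Refines I' I →
    ∀ (p q : Proc) → p ⊑unc[ I ] q → p ⊑unc[ I' ] q
lemma5p1 I I' I'⊑I p q p⊑q o' o'-names p-must = must-≈ (≈-sym regroup) (p⊑q o o-names (must-≈ regroup p-must))
  where
  open Regroup (λ j → proj₁ (I'⊑I j)) (λ j → ⟨ o' j ⟩)
  open SetoidReasoning ≈-setoid

  o : Fin (suc (n I)) → Proc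
  o i = toProc (block i)

  regroup : parAll o' ≈ parAll o
  regroup = begin
    parAll o'               ≡⟨ parAll≡⨂ o' ⟩
    ⨂ (λ j → ⟨ o' j ⟩)      ≈⟨ ⨂-regroup ⟩
    ⨂ block                 ≈⟨ ⨂-cong (λ i → ≈-sym (toProc-≈ (block i))) ⟩
    ⨂ (λ i → ⟨ o i ⟩)       ≡⟨ sym (parAll≡⨂ o) ⟩
    parAll o                ∎

  o-names : ∀ i a → a ∈n o i → part I (nm a) ≡ i
  o-names i a a∈ with block-names i (toProc-names (block i) a∈)
  ... | j , fj≡i , proc∈ a∈' = trans (proj₂ (I'⊑I j) (nm a) (o'-names j a a∈')) fj≡i
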